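{- Let $\Gamma_1$ and $\Gamma_2$ be signed graphs on $n_1$ and $n_2$ vertices, let $\lambda_{21},\dots,\lambda_{2n_2}$ be the adjacency eigenvalues of $\Gamma_2$, and let $\lambda'_{11},\dots,\lambda'_{1n_1}$ be the adjacency eigenvalues of the $\mu$-signed graph $\Gamma_{1\mu}$ of $\Gamma_1$. Then the adjacency characteristic polynomial of the duplication add vertex corona satisfies $$f(A(\Gamma_1\circledast\Gamma_2),x)=\det\big(xI-A(\Gamma_1\circledast\Gamma_2)\big)=\prod_{i=1}^{n_2}(x-\lambda_{2i})^{n_1}\prod_{i=1}^{n_1}\big(x^2-x\,\chi_{A(\Gamma_2)}(x)-{\lambda'}_{1i}^2\big).$$
   Context: A signed graph is $\Gamma=(G,\sigma,\mu)$ with $G$ a finite simple graph, $\sigma:E(G)\to\{\pm1\}$ a signature and $\mu:V(G)\to\{\pm1\}$ the canonical marking $\mu(u)=\prod_{e\ni u}\sigma(e)$. Its adjacency matrix $A(\Gamma)$ has $(i,j)$ entry $\sigma(u_iu_j)$ if $u_iu_j\in E(G)$ and $0$ otherwise. The $\mu$-signed graph $\Gamma_\mu$ has the same underlying graph and marking and signature $\sigma_\mu(uv)=\mu(u)\mu(v)$. The marking vector of $\Gamma$ with $V=\{w_1,\dots,w_n\}$ is $\mu(\Gamma)=(\mu(w_1),\dots,\mu(w_n))^T$, and the signed $A$-coronal is the rational function $\chi_{A(\Gamma)}(x)=\mu(\Gamma)^T(xI_n-A(\Gamma))^{ -1}\mu(\Gamma)$. Duplication signed graph $D\Gamma_1$: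 if $V(\Gamma_1)=\{u_1,\dots,u_{n_1}\}$, add new vertices $a_1,\dots,a_{n_1}$ with $\mu_1(a_i)=\mu_1(u_i)$; $D\Gamma_1$ has, for each edge $u_iu_j$ of $\Gamma_1$, an edge $a_iu_j$ of sign $\mu_1(a_i)\mu_1(u_j)$, and no other edges. With $V(\Gamma_2)=\{v_1,\dots,v_{n_2}\}$, $\Gamma_1\circledast\Gamma_2$ is obtained from $D\Gamma_1$ and $n_1$ disjoint copies of $\Gamma_2$ (the $i$-th copy with vertices $v^i_1,\dots,v^i_{n_2}$, signature and marking copied from $\Gamma_2$) by joining $a_i$ to every $v^i_j$ with an edge of sign $\mu_1(a_i)\mu_2(v_j)$, $i=1,\dots,n_1$. The identity is an identity of rational functions in $x$. -}

module Defs where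

open import Level using (Level; _⊔_)
open import Data.Nat as ℕ using (ℕ; zero; suc)
open import Data.Fin as Fin using (Fin; zero; suc; splitAt; quotient; remainder; punchIn)
open import Data.Fin.Properties using (_≟_)
open import Data.Maybe as Maybe using (Maybe; just; nothing; fromMaybe)
open import Data.Sign as Sign using (Sign)
import Data.Sign.Properties as SignP
open import Data.Sum using (inj₁; inj₂)
open import Data.Product using (∃)
open import Data.Empty using (⊥-elim)
open import Relation.Nullary using (Dec; yes; no; ¬_)
open import Relation.Binary.PropositionalEquality
open import Algebra.Bundles using (CommutativeRing)

-- Signed graphs on the vertex set Fin n.
-- edge i j = nothing      : i and j are not adjacent
-- edge i j = just s       : ij is an edge with sign σ(ij) = s
-- Symmetric and loopless, so the underlying graph is finite and simple.

record SignedGraph (n : ℕ) : Set where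
  field
    edge          : Fin n → Fin n → Maybe Sign
    edge-sym      : ∀ i j → edge i j ≡ edge j i
    edge-loopless : ∀ i → edge i i ≡ nothing
open SignedGraph public

signProd : ∀ {n} → (Fin n → Sign) → Sign
signProd {zero}  f = Sign.+
signProd {suc n} f = f zero Sign.* signProd (λ i → f (suc i))

-- canonical marking μ(u) = ∏_{e ∋ u} σ(e)  (non-edges contribute +)
marking : ∀ {n} → SignedGraph n → Fin n → Sign
marking Γ u = signProd (λ v → fromMaybe Sign.+ (edge Γ u v))

muGraph : ∀ {n} → SignedGraph n → SignedGraph n
muGraph Γ = record
  { edge = e
  ; edge-sym = sym′
  ; edge-loopless = loop
  }
  where
  μ = marking Γ
  e : _ → _ → Maybe Sign
  e i j = Maybe.map (λ _ → μ i Sign.* μ j) (edge Γ i j)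
  sym′ : ∀ i j → e i j ≡ e j i
  sym′ i j rewrite edge-sym Γ i j | SignP.*-comm (μ i) (μ j) = refl
  loop : ∀ i → e i i ≡ nothing
  loop i rewrite edge-loopless Γ i = refl

-- The duplication add vertex corona Γ₁ ⊛ Γ₂.
-- Vertices: u_j (original, Fin n₁), a_i (duplicates, Fin n₁),
-- v^i_k (vertex k of the i-th copy of Γ₂).

data CVertex (n₁ n₂ : ℕ) : Set where
  U : Fin n₁ → CVertex n₁ n₂
  A : Fin n₁ → CVertex n₁ n₂
  C : Fin n₁ → Fin n₂ → CVertex n₁ n₂

decode : ∀ n₁ n₂ → Fin (n₁ ℕ.+ (n₁ ℕ.+ n₁ ℕ.* n₂)) → CVertex n₁ n₂
decode n₁ n₂ x with splitAt n₁ x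
... | inj₁ j = U j
... | inj₂ y with splitAt n₁ y
... | inj₁ i = A i
... | inj₂ z = C (quotient n₂ z) (remainder {n₁} n₂ z)

guard : ∀ {p} {P : Set p} → Dec P → Maybe Sign → Maybe Sign
guard (yes _) m = m
guard (no _)  _ = nothing

module CoronaEdges {n₁ n₂ : ℕ} (Γ₁ : SignedGraph n₁) (Γ₂ : SignedGraph n₂) where
  μ₁ = marking Γ₁
  μ₂ = marking Γ₂

  -- a_i u_j is an edge iff u_i u_j ∈ E(Γ₁), with sign μ₁(a_i)μ₁(u_j) = μ₁(u_i)μ₁(u_j)
  au : Fin n₁ → Fin n₁ → Maybe Sign
  au i j = Maybe.map (λ _ → μ₁ i Sign.* μ₁ j) (edge Γ₁ i j)

  av : Fin n₁ → Fin n₁ → Fin n₂ → Maybe Sign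
  av i i' k = guard (i ≟ i') (just (μ₁ i Sign.* μ₂ k))

  vv : Fin n₁ → Fin n₂ → Fin n₁ → Fin n₂ → Maybe Sign
  vv i k i' l = guard (i ≟ i') (edge Γ₂ k l)

  cEdge : CVertex n₁ n₂ → CVertex n₁ n₂ → Maybe Sign
  cEdge (U j)   (U j′)   = nothing
  cEdge (U j)   (A i)    = au i j
  cEdge (U j)   (C i k)  = nothing
  cEdge (A i)   (U j)    = au i j
  cEdge (A i)   (A i′)   = nothing
  cEdge (A i)   (C i′ k) = av i i′ k
  cEdge (C i k) (U j)    = nothing
  cEdge (C i′ k) (A i)   = av i i′ k
  cEdge (C i k) (C i′ l) = vv i k i′ l

  cEdge-sym : ∀ x y → cEdge x y ≡ cEdge y x
  cEdge-sym (U j)   (U j′)   = refl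
  cEdge-sym (U j)   (A i)    = refl
  cEdge-sym (U j)   (C i k)  = refl
  cEdge-sym (A i)   (U j)    = refl
  cEdge-sym (A i)   (A i′)   = refl
  cEdge-sym (A i)   (C i′ k) = refl
  cEdge-sym (C i k) (U j)    = refl
  cEdge-sym (C i′ k) (A i)   = refl
  cEdge-sym (C i k) (C i′ l) with i ≟ i′ | i′ ≟ i
  ... | yes refl | yes _  = edge-sym Γ₂ k l
  ... | yes refl | no ne  = ⊥-elim (ne refl)
  ... | no ne    | yes refl = ⊥-elim (ne refl)
  ... | no _     | no _   = refl

  cEdge-loop : ∀ x → cEdge x x ≡ nothing
  cEdge-loop (U j) = refl
  cEdge-loop (A i) = refl
  cEdge-loop (C i k) with i ≟ i
  ... | yes _ = edge-loopless Γ₂ k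
  ... | no _  = refl

corona : ∀ {n₁ n₂} → SignedGraph n₁ → SignedGraph n₂
       → SignedGraph (n₁ ℕ.+ (n₁ ℕ.+ n₁ ℕ.* n₂))
corona {n₁} {n₂} Γ₁ Γ₂ = record
  { edge = λ x y → cEdge (decode n₁ n₂ x) (decode n₁ n₂ y)
  ; edge-sym = λ x y → cEdge-sym (decode n₁ n₂ x) (decode n₁ n₂ y)
  ; edge-loopless = λ x → cEdge-loop (decode n₁ n₂ x)
  }
  where open CoronaEdges Γ₁ Γ₂

-- Linear algebra over a commutative ring R (used with R a field of
-- characteristic 0, standing in for ℝ).

module Over {c ℓ : Level} (R : CommutativeRing c ℓ) where
  open CommutativeRing R hiding (zero)

  Matrix : ℕ → Set c
  Matrix n = Fin n → Fin n → Carrier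

  Σ : ∀ {n} → (Fin n → Carrier) → Carrier
  Σ {zero}  f = 0#
  Σ {suc n} f = f zero + Σ (λ i → f (suc i))

  Π : ∀ {n} → (Fin n → Carrier) → Carrier
  Π {zero}  f = 1#
  Π {suc n} f = f zero * Π (λ i → f (suc i))

  _^_ : Carrier → ℕ → Carrier
  x ^ zero  = 1#
  x ^ suc k = x * (x ^ k)

  natCast : ℕ → Carrier
  natCast zero    = 0#
  natCast (suc k) = 1# + natCast k

  signK : Sign → Carrier
  signK Sign.+ = 1#
  signK Sign.- = - 1#

  entry : Maybe Sign → Carrier
  entry nothing  = 0#
  entry (just s) = signK s

  adjMat : ∀ {n} → SignedGraph n → Matrix n
  adjMat Γ i j = entry (edge Γ i j)

  markVec : ∀ {n} → SignedGraph n → Fin n → Carrier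
  markVec Γ i = signK (marking Γ i)

  δ : ∀ {n} → Fin n → Fin n → Carrier
  δ i j with i ≟ j
  ... | yes _ = 1#
  ... | no _  = 0#

  charMat : ∀ {n} → Carrier → Matrix n → Matrix n
  charMat x M i j = x * δ i j - M i j

  _·_ : ∀ {n} → Matrix n → Matrix n → Matrix n
  (M · N) i j = Σ (λ k → M i k * N k j)

  IsInverse : ∀ {n} → Matrix n → Matrix n → Set ℓ
  IsInverse M B = (∀ i j → (M · B) i j ≈ δ i j) Data.Product.× (∀ i j → (B · M) i j ≈ δ i j)

  alt : ∀ {n} → Fin n → Carrier
  alt zero    = 1#
  alt (suc j) = - alt j

  minor : ∀ {n} → Fin (suc n) → Matrix (suc n) → Matrix n
  minor j M r s = M (suc r) (punchIn j s)

  det : ∀ {n} → Matrix n → Carrier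
  det {zero}  M = 1#
  det {suc n} M = Σ (λ j → alt j * M zero j * det (minor j M))

  charPoly : ∀ {n} → Matrix n → Carrier → Carrier
  charPoly M x = det (charMat x M)

  -- λ lists the eigenvalues of M with multiplicity:
  -- det(xI - M) = ∏ (x - λ_i)  (as polynomial functions; R is infinite)
  IsEigenvalues : ∀ {n} → Matrix n → (Fin n → Carrier) → Set (c ⊔ ℓ)
  IsEigenvalues M λs = ∀ x → charPoly M x ≈ Π (λ i → x - λs i)

  -- signed A-coronal μᵀ (xI - A)⁻¹ μ, where B = (xI - A)⁻¹
  coronal : ∀ {n} → SignedGraph n → Matrix n → Carrier
  coronal Γ B = Σ (λ i → Σ (λ j → markVec Γ i * B i j * markVec Γ j))

  record CharZeroField : Set (c ⊔ ℓ) where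
    field
      inverse  : ∀ x → ¬ (x ≈ 0#) → ∃ (λ y → x * y ≈ 1#)
      charZero : ∀ k → natCast k ≈ 0# → k ≡ 0

-- Order the vertices as u, a, copies of Γ₂.  Adding to each row aᵢ the
-- multiple μ₁(aᵢ) μ(Γ₂)ᵀ (x I - A(Γ₂))⁻¹ of the rows of the i-th copy of Γ₂
-- makes x I - A(Γ₁ ⊛ Γ₂) block lower triangular, with diagonal blocks n₁
-- copies of x I - A(Γ₂) and [[x I, -M], [-M, (x - χ) I]], where M = A(Γ₁μ)
-- and χ is the coronal; the diagonal of the a-rows picks up μ₁(aᵢ)² χ = χ.
--
-- If M has eigenvalues λ′ᵢ then det [[x I, -M], [-M, y I]] = ∏ (x y - λ′ᵢ²).
-- For invertible y a Schur complement turns it into det (x y I - M²), and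
-- det (t² I - M²) = det (t I - M) det (t I + M) by block row and column
-- operations.  Both sides of each identity are polynomials, so it suffices to
-- check them at the positive integers, which are invertible in
-- characteristic zero.

module Submission where

open import Defs
open import Level using (0ℓ; _⊔_)
open import Data.Nat as ℕ using (ℕ; zero; suc)
import Data.Nat.Properties as ℕ
open import Data.Fin as Fin using (Fin; zero; suc; toℕ; punchIn; _↑ˡ_; _↑ʳ_; splitAt; combine)
open import Data.Sum using (inj₁; inj₂; [_,_]′)
open import Data.Bool using (Bool; true; false; not)
import Data.Fin.Properties as Fin
open import Data.Product using (∃; _×_; _,_; proj₁; proj₂; uncurry)
open import Data.Maybe using (Maybe; just; nothing)
import Data.Sign as Sign
import Data.Sign.Properties as SignP
open import Data.Empty using (⊥-elim)
open import Data.Vec using (Vec; []; _∷_; _∷ʳ_; _++_; replicate)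
open import Relation.Binary.Definitions using (tri<; tri≈; tri>)
open import Relation.Nullary using (¬_; Dec; yes; no)
open import Relation.Binary.PropositionalEquality as ≡ using (_≡_; _≢_)
open import Function using (_∘_)
open import Algebra.Bundles using (CommutativeRing; RawRing)
open import Algebra.Solver.Ring.AlmostCommutativeRing
  using (fromCommutativeRing; _-Raw-AlmostCommutative⟶_)
import Algebra.Solver.Ring as RingSolver
import Algebra.Properties.Ring as RingProperties
import Algebra.Properties.CommutativeSemigroup as CommutativeSemigroupProperties

square-injective : ∀ {a b} → a ℕ.* a ≡ b ℕ.* b → a ≡ b
square-injective {a} {b} eq with ℕ.<-cmp a b
... | tri< a<b _ _ = ⊥-elim (ℕ.<-irrefl eq (ℕ.*-mono-< a<b a<b))
... | tri≈ _ a≡b _ = a≡b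
... | tri> _ _ b<a = ⊥-elim (ℕ.<-irrefl (≡.sym eq) (ℕ.*-mono-< b<a b<a))

module Development {c ℓ} (R : CommutativeRing c ℓ) where
  open CommutativeRing R hiding (zero)
  open Over R
  open RingProperties ring
  open CommutativeSemigroupProperties +-commutativeSemigroup using (interchange; x∙yz≈y∙xz)
  open CommutativeSemigroupProperties *-commutativeSemigroup using () renaming (interchange to *-interchange)
  open import Relation.Binary.Reasoning.Setoid setoid

  natCast-+ : ∀ m n → natCast (m ℕ.+ n) ≈ natCast m + natCast n
  natCast-+ zero    n = sym (+-identityˡ _)
  natCast-+ (suc m) n = trans (+-congˡ (natCast-+ m n)) (sym (+-assoc _ _ _))

  natCast-* : ∀ m n → natCast (m ℕ.* n) ≈ natCast m * natCast n
  natCast-* zero    n = sym (zeroˡ _)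
  natCast-* (suc m) n = begin
    natCast (n ℕ.+ m ℕ.* n)         ≈⟨ natCast-+ n (m ℕ.* n) ⟩
    natCast n + natCast (m ℕ.* n)   ≈⟨ +-cong (sym (*-identityˡ _)) (natCast-* m n) ⟩
    1# * natCast n + natCast m * natCast n ≈⟨ distribʳ _ _ _ ⟨
    (1# + natCast m) * natCast n    ∎

  -+-interchange : ∀ a b c d → (a - b) + (c - d) ≈ (a + c) - (b + d)
  -+-interchange a b c d = trans (interchange a (- b) c (- d)) (+-congˡ (-‿+-comm b d))

  -*-expand : ∀ a b c d → (a - b) * (c - d) ≈ (a * c + b * d) - (a * d + b * c)
  -*-expand a b c d = begin
    (a - b) * (c - d)                         ≈⟨ distribʳ (c - d) a (- b) ⟩
    a * (c - d) + - b * (c - d)               ≈⟨ +-cong (x[y-z]≈xy-xz a c d) (sym (-‿distribˡ-* b (c - d))) ⟩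
    (a * c - a * d) + - (b * (c - d))         ≈⟨ +-congˡ (-‿cong (x[y-z]≈xy-xz b c d)) ⟩
    (a * c - a * d) + - (b * c - b * d)       ≈⟨ +-congˡ (⁻¹-anti-homo‿- (b * c) (b * d)) ⟩
    (a * c - a * d) + (b * d - b * c)         ≈⟨ -+-interchange _ _ _ _ ⟩
    (a * c + b * d) - (a * d + b * c)         ∎

  -- The ring solver, with formal differences of naturals as coefficients
  -- (their equality is decidable, which the solver needs).

  private
    differences : RawRing 0ℓ 0ℓ
    differences = record
      { Carrier = ℕ × ℕ
      ; _≈_ = _≡_
      ; _+_ = λ (a , b) (c , d) → (a ℕ.+ c , b ℕ.+ d)
      ; _*_ = λ (a , b) (c , d) → (a ℕ.* c ℕ.+ b ℕ.* d , a ℕ.* d ℕ.+ b ℕ.* c)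
      ; -_ = λ (a , b) → (b , a)
      ; 0# = (0 , 0)
      ; 1# = (1 , 0)
      }

    ⟦_⟧ᵈ : ℕ × ℕ → Carrier
    ⟦ a , b ⟧ᵈ = natCast a - natCast b

    differences⟶R : differences -Raw-AlmostCommutative⟶ fromCommutativeRing R
    differences⟶R = record
      { ⟦_⟧ = ⟦_⟧ᵈ
      ; +-homo = λ (a , b) (c , d) →
          trans (+-cong (natCast-+ a c) (-‿cong (natCast-+ b d))) (sym (-+-interchange _ _ _ _))
      ; *-homo = λ (a , b) (c , d) →
          trans (+-cong (trans (natCast-+ (a ℕ.* c) (b ℕ.* d)) (+-cong (natCast-* a c) (natCast-* b d)))
                        (-‿cong (trans (natCast-+ (a ℕ.* d) (b ℕ.* c)) (+-cong (natCast-* a d) (natCast-* b c)))))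
                (sym (-*-expand _ _ _ _))
      ; -‿homo = λ (a , b) → sym (⁻¹-anti-homo‿- (natCast a) (natCast b))
      ; 0-homo = -‿inverseʳ 0#
      ; 1-homo = trans (+-cong (+-identityʳ 1#) -0#≈0#) (+-identityʳ 1#)
      }

    ⟦⟧ᵈ-cong : ∀ a b c d → a ℕ.+ d ≡ c ℕ.+ b → ⟦ a , b ⟧ᵈ ≈ ⟦ c , d ⟧ᵈ
    ⟦⟧ᵈ-cong a b c d eq = begin
      natCast a - natCast b                         ≈⟨ +-identityʳ _ ⟨
      (natCast a - natCast b) + 0#                  ≈⟨ +-congˡ (-‿inverseʳ (natCast d)) ⟨
      (natCast a - natCast b) + (natCast d - natCast d) ≈⟨ -+-interchange _ _ _ _ ⟩
      (natCast a + natCast d) - (natCast b + natCast d)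
        ≈⟨ +-cong (trans (sym (natCast-+ a d)) (trans (reflexive (≡.cong natCast eq)) (natCast-+ c b)))
                  (-‿cong (+-comm _ _)) ⟩
      (natCast c + natCast b) - (natCast d + natCast b) ≈⟨ -+-interchange _ _ _ _ ⟨
      (natCast c - natCast d) + (natCast b - natCast b) ≈⟨ +-congˡ (-‿inverseʳ _) ⟩
      (natCast c - natCast d) + 0#                  ≈⟨ +-identityʳ _ ⟩
      natCast c - natCast d                         ∎

    _≟ᵈ_ : ∀ x y → Maybe (⟦ x ⟧ᵈ ≈ ⟦ y ⟧ᵈ)
    (a , b) ≟ᵈ (c , d) with a ℕ.+ d ℕ.≟ c ℕ.+ b
    ... | yes eq = just (⟦⟧ᵈ-cong a b c d eq)
    ... | no _   = nothing

  open RingSolver differences (fromCommutativeRing R) differences⟶R _≟ᵈ_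
    using (solve; _:+_; _:*_; _:-_; :-_; _:=_)

  Σ-cong : ∀ {n} {f g : Fin n → Carrier} → (∀ i → f i ≈ g i) → Σ f ≈ Σ g
  Σ-cong {zero}  f≈g = refl
  Σ-cong {suc n} f≈g = +-cong (f≈g zero) (Σ-cong (λ i → f≈g (suc i)))

  Σ-≈0 : ∀ {n} {f : Fin n → Carrier} → (∀ i → f i ≈ 0#) → Σ f ≈ 0#
  Σ-≈0 {zero}  f≈0 = refl
  Σ-≈0 {suc n} f≈0 = trans (+-cong (f≈0 zero) (Σ-≈0 (λ i → f≈0 (suc i)))) (+-identityʳ 0#)

  Σ-distrib-+ : ∀ {n} (f g : Fin n → Carrier) → Σ (λ i → f i + g i) ≈ Σ f + Σ g
  Σ-distrib-+ {zero}  f g = sym (+-identityʳ 0#)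
  Σ-distrib-+ {suc n} f g =
    trans (+-congˡ (Σ-distrib-+ (λ i → f (suc i)) (λ i → g (suc i)))) (interchange _ _ _ _)

  Σ-*ˡ : ∀ {n} a (f : Fin n → Carrier) → Σ (λ i → a * f i) ≈ a * Σ f
  Σ-*ˡ {zero}  a f = sym (zeroʳ a)
  Σ-*ˡ {suc n} a f = trans (+-congˡ (Σ-*ˡ a (λ i → f (suc i)))) (sym (distribˡ _ _ _))

  Σ-*ʳ : ∀ {n} a (f : Fin n → Carrier) → Σ (λ i → f i * a) ≈ Σ f * a
  Σ-*ʳ a f = trans (Σ-cong (λ i → *-comm (f i) a)) (trans (Σ-*ˡ a f) (*-comm a _))

  Σ-neg : ∀ {n} (f : Fin n → Carrier) → Σ (λ i → - f i) ≈ - Σ f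
  Σ-neg f = begin
    Σ (λ i → - f i)      ≈⟨ Σ-cong (λ i → -1*x≈-x (f i)) ⟨
    Σ (λ i → - 1# * f i) ≈⟨ Σ-*ˡ (- 1#) f ⟩
    - 1# * Σ f           ≈⟨ -1*x≈-x _ ⟩
    - Σ f                ∎

  Σ-↑ : ∀ m {n} (f : Fin (m ℕ.+ n) → Carrier) →
        Σ f ≈ Σ (λ i → f (i ↑ˡ n)) + Σ (λ j → f (m ↑ʳ j))
  Σ-↑ zero    f = sym (+-identityˡ _)
  Σ-↑ (suc m) f = trans (+-congˡ (Σ-↑ m (λ i → f (suc i)))) (sym (+-assoc _ _ _))

  Σ-combine : ∀ m n (f : Fin (m ℕ.* n) → Carrier) →
              Σ f ≈ Σ (λ i → Σ (λ k → f (combine {m} {n} i k)))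
  Σ-combine zero    n f = refl
  Σ-combine (suc m) n f = trans (Σ-↑ n f) (+-congˡ (Σ-combine m n (λ p → f (n ↑ʳ p))))

  Σ-comm : ∀ {m n} (f : Fin m → Fin n → Carrier) →
           Σ (λ i → Σ (λ j → f i j)) ≈ Σ (λ j → Σ (λ i → f i j))
  Σ-comm {zero} {n} f = sym (Σ-≈0 {n} (λ _ → refl))
  Σ-comm {suc m} f = trans (+-congˡ (Σ-comm (λ i j → f (suc i) j)))
                           (sym (Σ-distrib-+ (f zero) (λ j → Σ (λ i → f (suc i) j))))

  Σ-punchIn : ∀ {n} (j : Fin (suc n)) (f : Fin (suc n) → Carrier) →
              Σ f ≈ f j + Σ (λ k → f (punchIn j k))
  Σ-punchIn zero f = refl
  Σ-punchIn {suc n} (suc j) f = begin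
    f zero + Σ (λ i → f (suc i))                           ≈⟨ +-congˡ (Σ-punchIn j (λ i → f (suc i))) ⟩
    f zero + (f (suc j) + Σ (λ k → f (suc (punchIn j k)))) ≈⟨ x∙yz≈y∙xz _ _ _ ⟩
    f (suc j) + (f zero + Σ (λ k → f (suc (punchIn j k)))) ∎

  δ-refl : ∀ {n} (i : Fin n) → δ i i ≈ 1#
  δ-refl i with i Fin.≟ i
  ... | yes _   = refl
  ... | no i≢i = ⊥-elim (i≢i ≡.refl)

  δ-≢ : ∀ {n} {i j : Fin n} → i ≢ j → δ i j ≈ 0#
  δ-≢ {i = i} {j} i≢j with i Fin.≟ j
  ... | yes i≡j = ⊥-elim (i≢j i≡j)
  ... | no _    = refl

  δ-sym : ∀ {n} (i j : Fin n) → δ i j ≈ δ j i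
  δ-sym i j with i Fin.≟ j | j Fin.≟ i
  ... | yes _   | yes _   = refl
  ... | no _    | no _    = refl
  ... | yes i≡j | no j≢i  = ⊥-elim (j≢i (≡.sym i≡j))
  ... | no i≢j  | yes j≡i = ⊥-elim (i≢j (≡.sym j≡i))

  δ-injective : ∀ {m n} {g : Fin m → Fin n} → (∀ {i j} → g i ≡ g j → i ≡ j) →
                ∀ i j → δ (g i) (g j) ≈ δ i j
  δ-injective {g = g} inj i j with i Fin.≟ j
  ... | yes ≡.refl = δ-refl (g i)
  ... | no i≢j     = δ-≢ (λ gi≡gj → i≢j (inj gi≡gj))

  Σ-δˡ : ∀ {n} (i : Fin n) (f : Fin n → Carrier) → Σ (λ j → δ i j * f j) ≈ f i
  Σ-δˡ {suc n} i f = begin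
    Σ (λ j → δ i j * f j)                                        ≈⟨ Σ-punchIn i (λ j → δ i j * f j) ⟩
    δ i i * f i + Σ (λ k → δ i (punchIn i k) * f (punchIn i k))
      ≈⟨ +-cong (trans (*-congʳ (δ-refl i)) (*-identityˡ _))
                (Σ-≈0 (λ k → trans (*-congʳ (δ-≢ (Fin.punchInᵢ≢i i k ∘ ≡.sym))) (zeroˡ _))) ⟩
    f i + 0#                                                     ≈⟨ +-identityʳ _ ⟩
    f i                                                          ∎

  Σ-δʳ : ∀ {n} (i : Fin n) (f : Fin n → Carrier) → Σ (λ j → f j * δ j i) ≈ f i
  Σ-δʳ i f = trans (Σ-cong (λ j → trans (*-comm _ _) (*-congʳ (δ-sym j i)))) (Σ-δˡ i f)

  Π-cong : ∀ {n} {f g : Fin n → Carrier} → (∀ i → f i ≈ g i) → Π f ≈ Π g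
  Π-cong {zero}  f≈g = refl
  Π-cong {suc n} f≈g = *-cong (f≈g zero) (Π-cong (λ i → f≈g (suc i)))

  Π-distrib-* : ∀ {n} (f g : Fin n → Carrier) → Π (λ i → f i * g i) ≈ Π f * Π g
  Π-distrib-* {zero}  f g = sym (*-identityʳ 1#)
  Π-distrib-* {suc n} f g =
    trans (*-congˡ (Π-distrib-* (λ i → f (suc i)) (λ i → g (suc i)))) (*-interchange _ _ _ _)

  ^-cong : ∀ {a b} m → a ≈ b → a ^ m ≈ b ^ m
  ^-cong zero    a≈b = refl
  ^-cong (suc m) a≈b = *-cong a≈b (^-cong m a≈b)

  ^-distrib-* : ∀ a b m → (a * b) ^ m ≈ a ^ m * b ^ m
  ^-distrib-* a b zero    = sym (*-identityʳ 1#)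
  ^-distrib-* a b (suc m) = trans (*-congˡ (^-distrib-* a b m)) (*-interchange _ _ _ _)

  Π-^ : ∀ {n} (f : Fin n → Carrier) m → Π (λ i → f i ^ m) ≈ Π f ^ m
  Π-^ {zero}  f m = sym (1^ m)
    where
    1^ : ∀ m → 1# ^ m ≈ 1#
    1^ zero    = refl
    1^ (suc m) = trans (*-identityˡ _) (1^ m)
  Π-^ {suc n} f m = trans (*-congˡ (Π-^ (λ i → f (suc i)) m)) (sym (^-distrib-* _ _ m))

  -- Determinants

  _ᵀ : ∀ {n} → Matrix n → Matrix n
  (M ᵀ) i j = M j i

  det-cong : ∀ {n} {M N : Matrix n} → (∀ i j → M i j ≈ N i j) → det M ≈ det N
  det-cong {zero}  M≈N = refl
  det-cong {suc n} {M} {N} M≈N =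
    Σ-cong {f = λ j → alt j * M zero j * det (minor j M)} {g = λ j → alt j * N zero j * det (minor j N)}
           (λ j → *-cong (*-congˡ (M≈N zero j)) (det-cong (λ r s → M≈N (suc r) (punchIn j s))))

  private
    coMinor : ∀ {k} → Fin (suc k) → Fin (suc k) → Matrix (suc (suc k)) → Matrix k
    coMinor i j M r s = M (suc (punchIn i s)) (suc (punchIn j r))

    coMinorTerm : ∀ {k} → Matrix (suc (suc k)) → Fin (suc k) → Fin (suc k) → Carrier
    coMinorTerm M i j = (alt j * alt i) * (M zero (suc j) * M (suc i) zero) * det (coMinor i j M)

  -- Each minor of the first row is expanded along its first column, i.e.
  -- along the first row of its transpose.
  det-expand₂ : ∀ {k} → (∀ (X : Matrix (suc k)) → det (X ᵀ) ≈ det X) → ∀ (M : Matrix (suc (suc k))) →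
                det M ≈ M zero zero * det (minor zero M) - Σ (λ j → Σ (λ i → coMinorTerm M i j))
  det-expand₂ det-ᵀ′ M =
    +-cong (*-congʳ (*-identityˡ _)) (trans (Σ-cong expandMinor) (Σ-neg (λ j → Σ (λ i → coMinorTerm M i j))))
    where
    expandMinor : ∀ j → alt (suc j) * M zero (suc j) * det (minor (suc j) M) ≈ - Σ (λ i → coMinorTerm M i j)
    expandMinor j = begin
      - alt j * M zero (suc j) * det (minor (suc j) M)
        ≈⟨ *-congˡ (det-ᵀ′ (minor (suc j) M)) ⟨
      - alt j * M zero (suc j) * Σ (λ i → alt i * M (suc i) zero * det (coMinor i j M))
        ≈⟨ Σ-*ˡ (- alt j * M zero (suc j)) (λ i → alt i * M (suc i) zero * det (coMinor i j M)) ⟨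
      Σ (λ i → - alt j * M zero (suc j) * (alt i * M (suc i) zero * det (coMinor i j M)))
        ≈⟨ Σ-cong (λ i → solve 5 (λ a b c d q → (:- a) :* b :* (c :* d :* q) := :- ((a :* c) :* (b :* d) :* q))
                                 refl (alt j) (M zero (suc j)) (alt i) (M (suc i) zero) (det (coMinor i j M))) ⟩
      Σ (λ i → - coMinorTerm M i j)
        ≈⟨ Σ-neg (λ i → coMinorTerm M i j) ⟩
      - Σ (λ i → coMinorTerm M i j) ∎

  det-ᵀ : ∀ {n} (M : Matrix n) → det (M ᵀ) ≈ det M
  det-ᵀ {zero}        M = refl
  det-ᵀ {suc zero}    M = refl
  det-ᵀ {suc (suc k)} M = begin
    det (M ᵀ)
      ≈⟨ det-expand₂ det-ᵀ (M ᵀ) ⟩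
    M zero zero * det (minor zero (M ᵀ)) - Σ (λ j → Σ (λ i → coMinorTerm (M ᵀ) i j))
      ≈⟨ +-cong (*-congˡ (det-ᵀ (minor zero M)))
                (-‿cong (trans (Σ-cong (λ j → Σ-cong (λ i → transposedTerm i j))) (Σ-comm (λ j i → coMinorTerm M j i)))) ⟩
    M zero zero * det (minor zero M) - Σ (λ j → Σ (λ i → coMinorTerm M i j))
      ≈⟨ det-expand₂ det-ᵀ M ⟨
    det M ∎
    where
    transposedTerm : ∀ i j → coMinorTerm (M ᵀ) i j ≈ coMinorTerm M j i
    transposedTerm i j = *-cong (*-cong (*-comm _ _) (*-comm _ _)) (det-ᵀ (coMinor j i M))

  swapCols₀₁ : ∀ {k} → Matrix (suc (suc k)) → Matrix (suc (suc k))
  swapCols₀₁ M i zero          = M i (suc zero)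
  swapCols₀₁ M i (suc zero)    = M i zero
  swapCols₀₁ M i (suc (suc j)) = M i (suc (suc j))

  swapRows₀₁ : ∀ {k} → Matrix (suc (suc k)) → Matrix (suc (suc k))
  swapRows₀₁ M = swapCols₀₁ (M ᵀ) ᵀ

  private
    laterColumns : ∀ {k} → Matrix (suc (suc k)) → Carrier
    laterColumns M = Σ (λ j → alt (suc (suc j)) * M zero (suc (suc j)) * det (minor (suc (suc j)) M))

  det-swapCols₀₁ : ∀ {k} (M : Matrix (suc (suc k))) → det (swapCols₀₁ M) ≈ - det M
  det-swapCols₀₁ {k} M = begin
    det (swapCols₀₁ M)
      ≈⟨ +-cong (*-congˡ (det-cong minor₀)) (+-cong (*-congˡ (det-cong minor₁)) (laterColumns-swap k M)) ⟩
    1# * b * y + (- 1# * a * x + - laterColumns M)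
      ≈⟨ solve 6 (λ o a b x y s → o :* b :* y :+ ((:- o) :* a :* x :+ :- s)
                                   := :- (o :* a :* x :+ ((:- o) :* b :* y :+ s))) refl 1# a b x y _ ⟩
    - det M ∎
    where
    a = M zero zero
    b = M zero (suc zero)
    x = det (minor zero M)
    y = det (minor (suc zero) M)
    minor₀ : ∀ r s → minor zero (swapCols₀₁ M) r s ≈ minor (suc zero) M r s
    minor₀ r zero    = refl
    minor₀ r (suc s) = refl
    minor₁ : ∀ r s → minor (suc zero) (swapCols₀₁ M) r s ≈ minor zero M r s
    minor₁ r zero    = refl
    minor₁ r (suc s) = refl
    laterColumns-swap : ∀ k (M : Matrix (suc (suc k))) → laterColumns (swapCols₀₁ M) ≈ - laterColumns M
    laterColumns-swap zero    M = sym -0#≈0#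
    laterColumns-swap (suc k) M =
      trans (Σ-cong swapped) (Σ-neg (λ j → alt (suc (suc j)) * M zero (suc (suc j)) * det (minor (suc (suc j)) M)))
      where
      minorₛₛ : ∀ j r s → minor (suc (suc j)) (swapCols₀₁ M) r s ≈ swapCols₀₁ (minor (suc (suc j)) M) r s
      minorₛₛ j r zero          = refl
      minorₛₛ j r (suc zero)    = refl
      minorₛₛ j r (suc (suc s)) = refl
      swapped : ∀ j → alt (suc (suc j)) * M zero (suc (suc j)) * det (minor (suc (suc j)) (swapCols₀₁ M))
                    ≈ - (alt (suc (suc j)) * M zero (suc (suc j)) * det (minor (suc (suc j)) M))
      swapped j = trans (*-congˡ (trans (det-cong (minorₛₛ j)) (det-swapCols₀₁ (minor (suc (suc j)) M))))
                        (sym (-‿distribʳ-* _ _))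

  det-swapRows₀₁ : ∀ {k} (M : Matrix (suc (suc k))) → det (swapRows₀₁ M) ≈ - det M
  det-swapRows₀₁ M = trans (det-ᵀ (swapCols₀₁ (M ᵀ))) (trans (det-swapCols₀₁ (M ᵀ)) (-‿cong (det-ᵀ M)))

  -- The expansion terms of columns 0 and 1 cancel; the other minors inherit the equal columns.
  det-equalCols₀₁ : ∀ {k} (M : Matrix (suc (suc k))) → (∀ i → M i zero ≈ M i (suc zero)) → det M ≈ 0#
  det-equalCols₀₁ {k} M M₀≈M₁ = begin
    det M
      ≈⟨ +-cong (*-cong (*-congˡ (M₀≈M₁ zero)) (det-cong minor₀≈minor₁)) (+-congˡ (laterColumns≈0 k M M₀≈M₁)) ⟩
    1# * b * y + (- 1# * b * y + 0#)
      ≈⟨ solve 4 (λ o b y z → o :* b :* y :+ ((:- o) :* b :* y :+ z) := z) refl 1# b y 0# ⟩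
    0# ∎
    where
    b = M zero (suc zero)
    y = det (minor (suc zero) M)
    minor₀≈minor₁ : ∀ r s → minor zero M r s ≈ minor (suc zero) M r s
    minor₀≈minor₁ r zero    = sym (M₀≈M₁ (suc r))
    minor₀≈minor₁ r (suc s) = refl
    laterColumns≈0 : ∀ k (M : Matrix (suc (suc k))) → (∀ i → M i zero ≈ M i (suc zero)) → laterColumns M ≈ 0#
    laterColumns≈0 zero    M _      = refl
    laterColumns≈0 (suc k) M M₀≈M₁ =
      Σ-≈0 {f = λ j → alt (suc (suc j)) * M zero (suc (suc j)) * det (minor (suc (suc j)) M)}
           (λ j → trans (*-congˡ (det-equalCols₀₁ (minor (suc (suc j)) M) (M₀≈M₁ ∘ suc))) (zeroʳ _))

  det-equalRows₀₁ : ∀ {k} (M : Matrix (suc (suc k))) → (∀ j → M zero j ≈ M (suc zero) j) → det M ≈ 0#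
  det-equalRows₀₁ M M₀≈M₁ = trans (sym (det-ᵀ M)) (det-equalCols₀₁ (M ᵀ) M₀≈M₁)

  mutual
    det-equalRows : ∀ {n} (M : Matrix n) {p q} → p ≢ q → (∀ j → M p j ≈ M q j) → det M ≈ 0#
    det-equalRows M {zero}  {zero}  p≢q = ⊥-elim (p≢q ≡.refl)
    det-equalRows M {zero}  {suc q} _   = det-equalRow₀ M q
    det-equalRows M {suc p} {zero}  _   Mp≈Mq = det-equalRow₀ M p (sym ∘ Mp≈Mq)
    det-equalRows M {suc p} {suc q} p≢q = det-equalRowsₛ M (p≢q ∘ ≡.cong suc)

    -- Swapping rows 0 and 1 moves the repeated row away from row 0.
    det-equalRow₀ : ∀ {n} (M : Matrix (suc n)) q → (∀ j → M zero j ≈ M (suc q) j) → det M ≈ 0#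
    det-equalRow₀ M zero    = det-equalRows₀₁ M
    det-equalRow₀ M (suc q) M₀≈Mq = begin
      det M                ≈⟨ -‿involutive _ ⟨
      - (- det M)          ≈⟨ -‿cong (det-swapRows₀₁ M) ⟨
      - det (swapRows₀₁ M) ≈⟨ -‿cong (det-equalRowsₛ (swapRows₀₁ M) {zero} {suc q} (λ ()) M₀≈Mq) ⟩
      - 0#                 ≈⟨ -0#≈0# ⟩
      0#                   ∎

    det-equalRowsₛ : ∀ {n} (M : Matrix (suc n)) {p q} → p ≢ q → (∀ j → M (suc p) j ≈ M (suc q) j) → det M ≈ 0#
    det-equalRowsₛ M p≢q Mp≈Mq =
      Σ-≈0 {f = λ j → alt j * M zero j * det (minor j M)}
           (λ j → trans (*-congˡ (det-equalRows (minor j M) p≢q (Mp≈Mq ∘ punchIn j))) (zeroʳ _))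

  det-linearRow : ∀ {m n} (q : Fin n) (c : Fin m → Carrier) (N : Fin m → Matrix n) (K : Matrix n) →
                  (∀ p i j → i ≢ q → N p i j ≈ K i j) → (∀ j → K q j ≈ Σ (λ p → c p * N p q j)) →
                  det K ≈ Σ (λ p → c p * det (N p))
  det-linearRow {m} {suc n} q c N K N≈K Kq≈ = begin
    Σ (λ j → alt j * K zero j * det (minor j K))  ≈⟨ Σ-cong (expandTerm q N≈K Kq≈) ⟩
    Σ (λ j → Σ (λ p → c p * term p j))          ≈⟨ Σ-comm (λ j p → c p * term p j) ⟩
    Σ (λ p → Σ (λ j → c p * term p j))          ≈⟨ Σ-cong (λ p → Σ-*ˡ (c p) (term p)) ⟩
    Σ (λ p → c p * det (N p))                   ∎
    where
    term : Fin m → Fin (suc n) → Carrier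
    term p j = alt j * N p zero j * det (minor j (N p))
    expandTerm : ∀ q → (∀ p i j → i ≢ q → N p i j ≈ K i j) → (∀ j → K q j ≈ Σ (λ p → c p * N p q j)) →
                 ∀ j → alt j * K zero j * det (minor j K) ≈ Σ (λ p → c p * term p j)
    expandTerm zero N≈K K₀≈ j = begin
      alt j * K zero j * det (minor j K)                       ≈⟨ *-congʳ (*-congˡ (K₀≈ j)) ⟩
      alt j * Σ (λ p → c p * N p zero j) * det (minor j K)     ≈⟨ *-congʳ (Σ-*ˡ (alt j) (λ p → c p * N p zero j)) ⟨
      Σ (λ p → alt j * (c p * N p zero j)) * det (minor j K)   ≈⟨ Σ-*ʳ (det (minor j K)) (λ p → alt j * (c p * N p zero j)) ⟨
      Σ (λ p → alt j * (c p * N p zero j) * det (minor j K))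
        ≈⟨ Σ-cong (λ p → trans (solve 4 (λ a c x d → a :* (c :* x) :* d := c :* (a :* x :* d)) refl _ _ _ _)
                               (*-congˡ (*-congˡ (det-cong (λ r s → sym (N≈K p (suc r) (punchIn j s) λ ())))))) ⟩
      Σ (λ p → c p * term p j)                                  ∎
    expandTerm (suc q) N≈K Kq≈ j = begin
      alt j * K zero j * det (minor j K)
        ≈⟨ *-congˡ (det-linearRow q c (λ p → minor j (N p)) (minor j K)
                     (λ p r s r≢q → N≈K p (suc r) (punchIn j s) (r≢q ∘ Fin.suc-injective)) (Kq≈ ∘ punchIn j)) ⟩
      alt j * K zero j * Σ (λ p → c p * det (minor j (N p)))
        ≈⟨ Σ-*ˡ (alt j * K zero j) (λ p → c p * det (minor j (N p))) ⟨
      Σ (λ p → alt j * K zero j * (c p * det (minor j (N p))))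
        ≈⟨ Σ-cong (λ p → trans (solve 4 (λ a k c d → a :* k :* (c :* d) := c :* (a :* k :* d)) refl _ _ _ _)
                               (*-congˡ (*-congʳ (*-congˡ (sym (N≈K p zero j λ ())))))) ⟩
      Σ (λ p → c p * term p j)                                  ∎

  setRow : ∀ {n} → Matrix n → Fin n → (Fin n → Carrier) → Matrix n
  setRow M q v i j with i Fin.≟ q
  ... | yes _ = v j
  ... | no _  = M i j

  setRow-≡ : ∀ {n} (M : Matrix n) q v j → setRow M q v q j ≈ v j
  setRow-≡ M q v j with q Fin.≟ q
  ... | yes _   = refl
  ... | no q≢q = ⊥-elim (q≢q ≡.refl)

  setRow-≢ : ∀ {n} (M : Matrix n) {q} v {i} j → i ≢ q → setRow M q v i j ≈ M i j
  setRow-≢ M {q} v {i} j i≢q with i Fin.≟ q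
  ... | yes i≡q = ⊥-elim (i≢q i≡q)
  ... | no _    = refl

  -- Linearity in row q splits det K into det M and determinants with a repeated row.
  det-addRowCombination : ∀ {n} (q : Fin n) (c : Fin n → Carrier) (M K : Matrix n) → c q ≈ 0# →
                          (∀ i j → i ≢ q → K i j ≈ M i j) → (∀ j → K q j ≈ M q j + Σ (λ p → c p * M p j)) →
                          det K ≈ det M
  det-addRowCombination {n} q c M K cq≈0 K≈M Kq≈ = begin
    det K                                       ≈⟨ det-linearRow q c′ N K N≈K Kq≈′ ⟩
    1# * det M + Σ (λ p → c p * det (N (suc p))) ≈⟨ +-cong (*-identityˡ _) (Σ-≈0 repeatedRow) ⟩
    det M + 0#                                  ≈⟨ +-identityʳ _ ⟩
    det M                                       ∎
    where
    c′ : Fin (suc n) → Carrier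
    c′ zero    = 1#
    c′ (suc p) = c p
    N : Fin (suc n) → Matrix n
    N zero    = M
    N (suc p) = setRow M q (M p)
    N≈K : ∀ p i j → i ≢ q → N p i j ≈ K i j
    N≈K zero    i j i≢q = sym (K≈M i j i≢q)
    N≈K (suc p) i j i≢q = trans (setRow-≢ M (M p) j i≢q) (sym (K≈M i j i≢q))
    Kq≈′ : ∀ j → K q j ≈ 1# * M q j + Σ (λ p → c p * N (suc p) q j)
    Kq≈′ j = trans (Kq≈ j) (+-cong (sym (*-identityˡ _)) (Σ-cong (λ p → *-congˡ (sym (setRow-≡ M q (M p) j)))))
    repeatedRow : ∀ p → c p * det (N (suc p)) ≈ 0#
    repeatedRow p with p Fin.≟ q
    ... | yes ≡.refl = trans (*-congʳ cq≈0) (zeroˡ _)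
    ... | no p≢q     = trans (*-congˡ (det-equalRows (N (suc p)) p≢q
                                        (λ j → trans (setRow-≢ M (M p) j p≢q) (sym (setRow-≡ M q (M p) j)))))
                             (zeroʳ _)

  -- The target rows are updated one at a time, in index order.
  det-addRows : ∀ {n} (target : Fin n → Bool) (c M K : Matrix n) →
                (∀ q p → target p ≡ true → c q p ≈ 0#) → (∀ q p → target q ≡ false → c q p ≈ 0#) →
                (∀ q j → K q j ≈ M q j + Σ (λ p → c q p * M p j)) → det K ≈ det M
  det-addRows {n} target c M K fromSources intoTargets K≈ =
    trans (det-cong (λ i j → sym (mixed-< n i j (Fin.toℕ<n i)))) (det-mixed n ℕ.≤-refl)
    where
    mixed : ℕ → Matrix n
    mixed t i j with toℕ i ℕ.<? t
    ... | yes _ = K i j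
    ... | no _  = M i j

    mixed-< : ∀ t i j → toℕ i ℕ.< t → mixed t i j ≈ K i j
    mixed-< t i j i<t with toℕ i ℕ.<? t
    ... | yes _   = refl
    ... | no i≮t = ⊥-elim (i≮t i<t)

    mixed-≮ : ∀ t i j → ¬ toℕ i ℕ.< t → mixed t i j ≈ M i j
    mixed-≮ t i j i≮t with toℕ i ℕ.<? t
    ... | yes i<t = ⊥-elim (i≮t i<t)
    ... | no _    = refl

    mixed-source : ∀ t p j → target p ≡ false → mixed t p j ≈ M p j
    mixed-source t p j source with toℕ p ℕ.<? t
    ... | no _  = refl
    ... | yes _ = trans (K≈ p j) (trans (+-congˡ (Σ-≈0 (λ p′ → trans (*-congʳ (intoTargets p p′ source)) (zeroˡ _))))
                                        (+-identityʳ _))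

    det-mixed : ∀ t → t ℕ.≤ n → det (mixed t) ≈ det M
    det-mixed zero    _   = det-cong (λ i j → mixed-≮ zero i j λ ())
    det-mixed (suc t) t<n =
      trans (det-addRowCombination q (c q) (mixed t) (mixed (suc t)) cqq≈0 otherRows rowq) (det-mixed t (ℕ.<⇒≤ t<n))
      where
      q : Fin n
      q = Fin.fromℕ< t<n
      q≡t : toℕ q ≡ t
      q≡t = Fin.toℕ-fromℕ< t<n

      cqq≈0 : c q q ≈ 0#
      cqq≈0 with target q in eq
      ... | true  = fromSources q q eq
      ... | false = intoTargets q q eq

      otherRows : ∀ i j → i ≢ q → mixed (suc t) i j ≈ mixed t i j
      otherRows i j i≢q = byCases (toℕ i ℕ.<? t)
        where
        byCases : Dec (toℕ i ℕ.< t) → mixed (suc t) i j ≈ mixed t i j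
        byCases (yes i<t) = trans (mixed-< (suc t) i j (ℕ.m<n⇒m<1+n i<t)) (sym (mixed-< t i j i<t))
        byCases (no i≮t)  = trans (mixed-≮ (suc t) i j i≮1+t) (sym (mixed-≮ t i j i≮t))
          where
          i≮1+t : ¬ toℕ i ℕ.< suc t
          i≮1+t i<1+t = i≢q (Fin.toℕ-injective (≡.trans (ℕ.≤-antisym (ℕ.s≤s⁻¹ i<1+t) (ℕ.≮⇒≥ i≮t)) (≡.sym q≡t)))

      rowq : ∀ j → mixed (suc t) q j ≈ mixed t q j + Σ (λ p → c q p * mixed t p j)
      rowq j = begin
        mixed (suc t) q j                    ≈⟨ mixed-< (suc t) q j (ℕ.≤-reflexive (≡.cong suc q≡t)) ⟩
        K q j                                ≈⟨ K≈ q j ⟩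
        M q j + Σ (λ p → c q p * M p j)      ≈⟨ +-cong (sym (mixed-≮ t q j (ℕ.<-irrefl q≡t))) (Σ-cong sourceTerm) ⟩
        mixed t q j + Σ (λ p → c q p * mixed t p j) ∎
        where
        sourceTerm : ∀ p → c q p * M p j ≈ c q p * mixed t p j
        sourceTerm p with target p in eq
        ... | true  = trans (*-congʳ (fromSources q p eq)) (trans (zeroˡ _) (sym (trans (*-congʳ (fromSources q p eq)) (zeroˡ _))))
        ... | false = *-congˡ (sym (mixed-source t p j eq))

  det-scaleRows : ∀ {n} (d : Fin n → Carrier) (M : Matrix n) → det (λ i j → d i * M i j) ≈ Π d * det M
  det-scaleRows {zero}  d M = sym (*-identityˡ 1#)
  det-scaleRows {suc n} d M = begin
    Σ (λ j → alt j * (d zero * M zero j) * det (λ r s → d (suc r) * M (suc r) (punchIn j s)))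
      ≈⟨ Σ-cong {g = λ j → Π d * (alt j * M zero j * det (minor j M))}
                (λ j → trans (*-congˡ (det-scaleRows (λ r → d (suc r)) (minor j M)))
                              (solve 5 (λ a d m p x → a :* (d :* m) :* (p :* x) := (d :* p) :* (a :* m :* x))
                                     refl (alt j) (d zero) (M zero j) (Π (λ r → d (suc r))) (det (minor j M)))) ⟩
    Σ (λ j → Π d * (alt j * M zero j * det (minor j M)))
      ≈⟨ Σ-*ˡ (Π d) (λ j → alt j * M zero j * det (minor j M)) ⟩
    Π d * det M ∎

  det-δ : ∀ n → det {n} δ ≈ 1#
  det-δ zero    = refl
  det-δ (suc n) = begin
    1# * δ {suc n} zero zero * det (minor zero (δ {suc n}))
      + Σ (λ j → alt (suc j) * δ {suc n} zero (suc j) * det (minor (suc j) (δ {suc n})))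
      ≈⟨ +-cong (*-cong (trans (*-identityˡ _) (δ-refl {suc n} zero))
                        (trans (det-cong {M = minor zero (δ {suc n})} {N = δ {n}} (δ-injective Fin.suc-injective))
                               (det-δ n)))
                (Σ-≈0 {f = λ j → alt (suc j) * δ {suc n} zero (suc j) * det (minor (suc j) (δ {suc n}))}
                      (λ j → trans (*-congʳ (trans (*-congˡ (δ-≢ {i = zero} {j = suc j} λ ())) (zeroʳ _))) (zeroˡ _))) ⟩
    1# * 1# + 0# ≈⟨ trans (+-identityʳ _) (*-identityˡ 1#) ⟩
    1# ∎

  det-diagonal : ∀ {n} (d : Fin n → Carrier) → det (λ i j → d i * δ i j) ≈ Π d
  det-diagonal {n} d = trans (det-scaleRows d δ) (trans (*-congˡ (det-δ n)) (*-identityʳ _))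

  -- Block matrices

  data BlockIndex (m k : ℕ) : Fin (m ℕ.+ k) → Set where
    upper : ∀ a → BlockIndex m k (a ↑ˡ k)
    lower : ∀ b → BlockIndex m k (m ↑ʳ b)

  blockIndex : ∀ m {k} (i : Fin (m ℕ.+ k)) → BlockIndex m k i
  blockIndex m {k} i with splitAt m i in eq
  ... | inj₁ a = ≡.subst (BlockIndex m k) (Fin.splitAt⁻¹-↑ˡ eq) (upper a)
  ... | inj₂ b = ≡.subst (BlockIndex m k) (Fin.splitAt⁻¹-↑ʳ eq) (lower b)

  Block : ℕ → ℕ → Set c
  Block m k = Fin m → Fin k → Carrier

  fromBlocks : ∀ {m k} → Block m m → Block m k → Block k m → Block k k → Matrix (m ℕ.+ k)
  fromBlocks {m} TL TR BL BR i j =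
    [ (λ a → [ TL a , TR a ]′ (splitAt m j)) , (λ b → [ BL b , BR b ]′ (splitAt m j)) ]′ (splitAt m i)

  module _ {m k} (TL : Block m m) (TR : Block m k) (BL : Block k m) (BR : Block k k) where

    fromBlocks-ˡˡ : ∀ a a′ → fromBlocks TL TR BL BR (a ↑ˡ k) (a′ ↑ˡ k) ≡ TL a a′
    fromBlocks-ˡˡ a a′ rewrite Fin.splitAt-↑ˡ m a k | Fin.splitAt-↑ˡ m a′ k = ≡.refl

    fromBlocks-ˡʳ : ∀ a b → fromBlocks TL TR BL BR (a ↑ˡ k) (m ↑ʳ b) ≡ TR a b
    fromBlocks-ˡʳ a b rewrite Fin.splitAt-↑ˡ m a k | Fin.splitAt-↑ʳ m k b = ≡.refl

    fromBlocks-ʳˡ : ∀ b a → fromBlocks TL TR BL BR (m ↑ʳ b) (a ↑ˡ k) ≡ BL b a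
    fromBlocks-ʳˡ b a rewrite Fin.splitAt-↑ʳ m k b | Fin.splitAt-↑ˡ m a k = ≡.refl

    fromBlocks-ʳʳ : ∀ b b′ → fromBlocks TL TR BL BR (m ↑ʳ b) (m ↑ʳ b′) ≡ BR b b′
    fromBlocks-ʳʳ b b′ rewrite Fin.splitAt-↑ʳ m k b | Fin.splitAt-↑ʳ m k b′ = ≡.refl

  private
    punchIn-↑ˡ : ∀ {m} k (j : Fin (suc m)) (s : Fin m) → punchIn (j ↑ˡ k) (s ↑ˡ k) ≡ punchIn j s ↑ˡ k
    punchIn-↑ˡ k zero    s       = ≡.refl
    punchIn-↑ˡ k (suc j) zero    = ≡.refl
    punchIn-↑ˡ k (suc j) (suc s) = ≡.cong suc (punchIn-↑ˡ k j s)

    punchIn-↑ʳ : ∀ {m} k (j : Fin (suc m)) (s : Fin k) → punchIn (j ↑ˡ k) (m ↑ʳ s) ≡ suc (m ↑ʳ s)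
    punchIn-↑ʳ k zero            s = ≡.refl
    punchIn-↑ʳ {suc m} k (suc j) s = ≡.cong suc (punchIn-↑ʳ k j s)

    alt-↑ˡ : ∀ {m} k (j : Fin m) → alt (j ↑ˡ k) ≈ alt j
    alt-↑ˡ k zero    = refl
    alt-↑ˡ k (suc j) = -‿cong (alt-↑ˡ k j)

  -- Only the expansion terms of the upper-left columns survive, and their
  -- minors are again block lower triangular.
  det-blockLowerTriangular : ∀ m {k} (M : Matrix (m ℕ.+ k)) → (∀ a b → M (a ↑ˡ k) (m ↑ʳ b) ≈ 0#) →
    det M ≈ det (λ a a′ → M (a ↑ˡ k) (a′ ↑ˡ k)) * det (λ b b′ → M (m ↑ʳ b) (m ↑ʳ b′))
  det-blockLowerTriangular zero    M _     = sym (*-identityˡ _)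
  det-blockLowerTriangular (suc m) {k} M TR≈0 = begin
    Σ (λ j → alt j * M zero j * det (minor j M))
      ≈⟨ Σ-↑ (suc m) (λ j → alt j * M zero j * det (minor j M)) ⟩
    Σ (λ a → alt (a ↑ˡ k) * M zero (a ↑ˡ k) * det (minor (a ↑ˡ k) M))
      + Σ (λ b → alt (suc m ↑ʳ b) * M zero (suc m ↑ʳ b) * det (minor (suc m ↑ʳ b) M))
      ≈⟨ +-cong (Σ-cong upperTerm) (Σ-≈0 (λ b → trans (*-congʳ (trans (*-congˡ (TR≈0 zero b)) (zeroʳ _))) (zeroˡ _))) ⟩
    Σ (λ a → alt a * TL zero a * det (minor a TL) * det BR) + 0#
      ≈⟨ trans (+-identityʳ _) (Σ-*ʳ (det BR) (λ a → alt a * TL zero a * det (minor a TL))) ⟩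
    det TL * det BR ∎
    where
    TL : Matrix (suc m)
    TL a a′ = M (a ↑ˡ k) (a′ ↑ˡ k)
    BR : Matrix k
    BR b b′ = M (suc m ↑ʳ b) (suc m ↑ʳ b′)
    upperTerm : ∀ a → alt (a ↑ˡ k) * M zero (a ↑ˡ k) * det (minor (a ↑ˡ k) M) ≈ alt a * TL zero a * det (minor a TL) * det BR
    upperTerm a = begin
      alt (a ↑ˡ k) * M zero (a ↑ˡ k) * det (minor (a ↑ˡ k) M)
        ≈⟨ *-cong (*-congʳ (alt-↑ˡ k a))
                  (det-blockLowerTriangular m (minor (a ↑ˡ k) M)
                    (λ r s → trans (reflexive (≡.cong (M (suc (r ↑ˡ k))) (punchIn-↑ʳ k a s))) (TR≈0 (suc r) s))) ⟩
      alt a * TL zero a * (det (λ r s → M (suc (r ↑ˡ k)) (punchIn (a ↑ˡ k) (s ↑ˡ k)))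
                           * det (λ r s → M (suc (m ↑ʳ r)) (punchIn (a ↑ˡ k) (m ↑ʳ s))))
        ≈⟨ *-congˡ (*-cong (det-cong (λ r s → reflexive (≡.cong (M (suc (r ↑ˡ k))) (punchIn-↑ˡ k a s))))
                           (det-cong (λ r s → reflexive (≡.cong (M (suc (m ↑ʳ r))) (punchIn-↑ʳ k a s))))) ⟩
      alt a * TL zero a * (det (minor a TL) * det BR) ≈⟨ *-assoc _ _ _ ⟨
      alt a * TL zero a * det (minor a TL) * det BR   ∎

  det-fromBlocks-lowerTriangular : ∀ {m k} (TL : Block m m) (TR : Block m k) (BL : Block k m) (BR : Block k k) →
    (∀ a b → TR a b ≈ 0#) → det (fromBlocks TL TR BL BR) ≈ det TL * det BR
  det-fromBlocks-lowerTriangular {m} TL TR BL BR TR≈0 = trans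
    (det-blockLowerTriangular m (fromBlocks TL TR BL BR) (λ a b → trans (reflexive (fromBlocks-ˡʳ TL TR BL BR a b)) (TR≈0 a b)))
    (*-cong (det-cong (λ a a′ → reflexive (fromBlocks-ˡˡ TL TR BL BR a a′)))
            (det-cong (λ b b′ → reflexive (fromBlocks-ʳʳ TL TR BL BR b b′))))

  private
    isUpper : ∀ m {k} → Fin (m ℕ.+ k) → Bool
    isUpper m i = [ (λ _ → true) , (λ _ → false) ]′ (splitAt m i)

    isUpper-↑ˡ : ∀ m {k} (a : Fin m) → isUpper m (a ↑ˡ k) ≡ true
    isUpper-↑ˡ m {k} a rewrite Fin.splitAt-↑ˡ m a k = ≡.refl

    isUpper-↑ʳ : ∀ m {k} (b : Fin k) → isUpper m (m ↑ʳ b) ≡ false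
    isUpper-↑ʳ m {k} b rewrite Fin.splitAt-↑ʳ m k b = ≡.refl

    true≢false : true ≢ false
    true≢false ()

    O : ∀ {m k} → Block m k
    O _ _ = 0#

  det-addToUpperRows : ∀ m {k} (X : Block m k) (M K : Matrix (m ℕ.+ k)) →
    (∀ a j → K (a ↑ˡ k) j ≈ M (a ↑ˡ k) j + Σ (λ b → X a b * M (m ↑ʳ b) j)) →
    (∀ b j → K (m ↑ʳ b) j ≈ M (m ↑ʳ b) j) → det K ≈ det M
  det-addToUpperRows m {k} X M K upperRows lowerRows =
    det-addRows (isUpper m) coeff M K fromLower intoUpper K≈
    where
    coeff : Matrix (m ℕ.+ k)
    coeff = fromBlocks O X O O
    fromLower : ∀ q p → isUpper m p ≡ true → coeff q p ≈ 0#
    fromLower q p p-upper with blockIndex m p | blockIndex m q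
    ... | upper a′ | upper a = reflexive (fromBlocks-ˡˡ O X O O a a′)
    ... | upper a′ | lower b = reflexive (fromBlocks-ʳˡ O X O O b a′)
    ... | lower b′ | _       = ⊥-elim (true≢false (≡.trans (≡.sym p-upper) (isUpper-↑ʳ m b′)))
    intoUpper : ∀ q p → isUpper m q ≡ false → coeff q p ≈ 0#
    intoUpper q p q-lower with blockIndex m q | blockIndex m p
    ... | upper a | _        = ⊥-elim (true≢false (≡.trans (≡.sym (isUpper-↑ˡ m a)) q-lower))
    ... | lower b | upper a′ = reflexive (fromBlocks-ʳˡ O X O O b a′)
    ... | lower b | lower b′ = reflexive (fromBlocks-ʳʳ O X O O b b′)
    K≈ : ∀ q j → K q j ≈ M q j + Σ (λ p → coeff q p * M p j)
    K≈ q j with blockIndex m q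
    ... | upper a = trans (upperRows a j) (+-congˡ (sym (begin
      Σ (λ p → coeff (a ↑ˡ k) p * M p j)
        ≈⟨ Σ-↑ m (λ p → coeff (a ↑ˡ k) p * M p j) ⟩
      Σ (λ a′ → coeff (a ↑ˡ k) (a′ ↑ˡ k) * M (a′ ↑ˡ k) j) + Σ (λ b → coeff (a ↑ˡ k) (m ↑ʳ b) * M (m ↑ʳ b) j)
        ≈⟨ +-cong (Σ-≈0 (λ a′ → trans (*-congʳ (reflexive (fromBlocks-ˡˡ O X O O a a′))) (zeroˡ _)))
                  (Σ-cong (λ b → *-congʳ (reflexive (fromBlocks-ˡʳ O X O O a b)))) ⟩
      0# + Σ (λ b → X a b * M (m ↑ʳ b) j)
        ≈⟨ +-identityˡ _ ⟩
      Σ (λ b → X a b * M (m ↑ʳ b) j) ∎)))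
    ... | lower b = trans (lowerRows b j)
                          (sym (trans (+-congˡ (Σ-≈0 (λ p → trans (*-congʳ (intoUpper (m ↑ʳ b) p (isUpper-↑ʳ m b))) (zeroˡ _))))
                                                      (+-identityʳ _)))

  det-addToLowerRows : ∀ m {k} (X : Block k m) (M K : Matrix (m ℕ.+ k)) →
    (∀ a j → K (a ↑ˡ k) j ≈ M (a ↑ˡ k) j) →
    (∀ b j → K (m ↑ʳ b) j ≈ M (m ↑ʳ b) j + Σ (λ a → X b a * M (a ↑ˡ k) j)) → det K ≈ det M
  det-addToLowerRows m {k} X M K upperRows lowerRows =
    det-addRows (not ∘ isUpper m) coeff M K fromUpper intoLower K≈
    where
    coeff : Matrix (m ℕ.+ k)
    coeff = fromBlocks O O X O
    fromUpper : ∀ q p → not (isUpper m p) ≡ true → coeff q p ≈ 0#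
    fromUpper q p p-lower with blockIndex m p | blockIndex m q
    ... | upper a′ | _       = ⊥-elim (true≢false (≡.trans (≡.sym p-lower) (≡.cong not (isUpper-↑ˡ m a′))))
    ... | lower b′ | upper a = reflexive (fromBlocks-ˡʳ O O X O a b′)
    ... | lower b′ | lower b = reflexive (fromBlocks-ʳʳ O O X O b b′)
    intoLower : ∀ q p → not (isUpper m q) ≡ false → coeff q p ≈ 0#
    intoLower q p q-upper with blockIndex m q | blockIndex m p
    ... | lower b | _        = ⊥-elim (true≢false (≡.trans (≡.sym (≡.cong not (isUpper-↑ʳ m b))) q-upper))
    ... | upper a | upper a′ = reflexive (fromBlocks-ˡˡ O O X O a a′)
    ... | upper a | lower b′ = reflexive (fromBlocks-ˡʳ O O X O a b′)
    K≈ : ∀ q j → K q j ≈ M q j + Σ (λ p → coeff q p * M p j)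
    K≈ q j with blockIndex m q
    ... | upper a = trans (upperRows a j)
                          (sym (trans (+-congˡ (Σ-≈0 (λ p → trans (*-congʳ (intoLower (a ↑ˡ k) p (≡.cong not (isUpper-↑ˡ m a))))
                                                                (zeroˡ _))))
                                                      (+-identityʳ _)))
    ... | lower b = trans (lowerRows b j) (+-congˡ (sym (begin
      Σ (λ p → coeff (m ↑ʳ b) p * M p j)
        ≈⟨ Σ-↑ m (λ p → coeff (m ↑ʳ b) p * M p j) ⟩
      Σ (λ a → coeff (m ↑ʳ b) (a ↑ˡ k) * M (a ↑ˡ k) j) + Σ (λ b′ → coeff (m ↑ʳ b) (m ↑ʳ b′) * M (m ↑ʳ b′) j)
        ≈⟨ +-cong (Σ-cong (λ a → *-congʳ (reflexive (fromBlocks-ʳˡ O O X O b a))))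
                  (Σ-≈0 (λ b′ → trans (*-congʳ (reflexive (fromBlocks-ʳʳ O O X O b b′))) (zeroˡ _))) ⟩
      Σ (λ a → X b a * M (a ↑ˡ k) j) + 0#
        ≈⟨ +-identityʳ _ ⟩
      Σ (λ a → X b a * M (a ↑ˡ k) j) ∎)))

  det-addToRightColumns : ∀ m {k} (X : Block m k) (M K : Matrix (m ℕ.+ k)) →
    (∀ i a → K i (a ↑ˡ k) ≈ M i (a ↑ˡ k)) →
    (∀ i b → K i (m ↑ʳ b) ≈ M i (m ↑ʳ b) + Σ (λ a → M i (a ↑ˡ k) * X a b)) → det K ≈ det M
  det-addToRightColumns m X M K leftColumns rightColumns = begin
    det K       ≈⟨ det-ᵀ K ⟨
    det (K ᵀ)   ≈⟨ det-addToLowerRows m (λ b a → X a b) (M ᵀ) (K ᵀ) (λ a i → leftColumns i a)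
                     (λ b i → trans (rightColumns i b) (+-congˡ (Σ-cong (λ a → *-comm (M i (a ↑ˡ _)) (X a b))))) ⟩
    det (M ᵀ)   ≈⟨ det-ᵀ M ⟩
    det M       ∎

  det-blockDiagonal : ∀ m {n} (G : Matrix (m ℕ.* n)) (D : Matrix n) →
    (∀ (i j : Fin m) (k l : Fin n) → G (combine i k) (combine j l) ≈ δ i j * D k l) → det G ≈ det D ^ m
  det-blockDiagonal zero    G D _      = refl
  det-blockDiagonal (suc m) {n} G D G≈ = begin
    det G
      ≈⟨ det-blockLowerTriangular n G offDiagonal ⟩
    det (λ k l → G (k ↑ˡ m ℕ.* n) (l ↑ˡ m ℕ.* n)) * det (λ p p′ → G (n ↑ʳ p) (n ↑ʳ p′))
      ≈⟨ *-cong (det-cong {N = D} (λ k l → trans (G≈ zero zero k l) (trans (*-congʳ (δ-refl {suc m} zero)) (*-identityˡ _))))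
                (det-blockDiagonal m (λ p p′ → G (n ↑ʳ p) (n ↑ʳ p′)) D
                   (λ i j k l → trans (G≈ (suc i) (suc j) k l) (*-congʳ (δ-injective Fin.suc-injective i j)))) ⟩
    det D * det D ^ m ∎
    where
    offDiagonal : ∀ k p → G (k ↑ˡ m ℕ.* n) (n ↑ʳ p) ≈ 0#
    offDiagonal k p = begin
      G (k ↑ˡ m ℕ.* n) (n ↑ʳ p)
        ≈⟨ reflexive (≡.cong (λ p → G (k ↑ˡ m ℕ.* n) (n ↑ʳ p)) (Fin.combine-remQuot {m} n p)) ⟨
      G (combine {suc m} zero k) (combine (suc q) r) ≈⟨ G≈ zero (suc q) k r ⟩
      δ zero (suc q) * D k r                         ≈⟨ trans (*-congʳ (δ-≢ {i = zero} {j = suc q} λ ())) (zeroˡ _) ⟩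
      0#                                       ∎
      where
      q = Fin.quotient {m} n p
      r = Fin.remainder {m} n p

  det-cast : ∀ {m n} (e : m ≡ n) (M : Matrix n) → det (λ i j → M (Fin.cast e i) (Fin.cast e j)) ≈ det M
  det-cast ≡.refl M = det-cong (λ i j → reflexive (≡.cong₂ M (Fin.cast-is-id _ i) (Fin.cast-is-id _ j)))

  crossBlock : ∀ {n} → Carrier → Carrier → Matrix n → Matrix (n ℕ.+ n)
  crossBlock x y M = fromBlocks (λ a a′ → x * δ a a′) (λ a b → - M a b) (λ b a → - M b a) (λ b b′ → y * δ b b′)

  module _ {n} (x y : Carrier) (M : Matrix n) where

    crossBlock-ˡˡ : ∀ a a′ → crossBlock x y M (a ↑ˡ n) (a′ ↑ˡ n) ≈ x * δ a a′
    crossBlock-ˡˡ a a′ = reflexive (fromBlocks-ˡˡ _ (λ a b → - M a b) (λ b a → - M b a) (λ b b′ → y * δ b b′) a a′)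

    crossBlock-ˡʳ : ∀ a b → crossBlock x y M (a ↑ˡ n) (n ↑ʳ b) ≈ - M a b
    crossBlock-ˡʳ a b = reflexive (fromBlocks-ˡʳ (λ a a′ → x * δ a a′) _ (λ b a → - M b a) (λ b b′ → y * δ b b′) a b)

    crossBlock-ʳˡ : ∀ b a → crossBlock x y M (n ↑ʳ b) (a ↑ˡ n) ≈ - M b a
    crossBlock-ʳˡ b a = reflexive (fromBlocks-ʳˡ (λ a a′ → x * δ a a′) (λ a b → - M a b) _ (λ b b′ → y * δ b b′) b a)

    crossBlock-ʳʳ : ∀ b b′ → crossBlock x y M (n ↑ʳ b) (n ↑ʳ b′) ≈ y * δ b b′
    crossBlock-ʳʳ b b′ = reflexive (fromBlocks-ʳʳ (λ a a′ → x * δ a a′) (λ a b → - M a b) (λ b a → - M b a) _ b b′)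

  -- Clearing the upper right block with y⁻¹ M times the lower rows leaves the
  -- Schur complement x I - y⁻¹ M² next to y I.
  det-crossBlock-schur : ∀ {n} (M : Matrix n) x y y⁻¹ → y * y⁻¹ ≈ 1# →
                         det (crossBlock x y M) ≈ charPoly (M · M) (x * y)
  det-crossBlock-schur {n} M x y y⁻¹ yy⁻¹≈1 = begin
    det (crossBlock x y M)            ≈⟨ det-addToUpperRows n (λ a b → y⁻¹ * M a b) (crossBlock x y M) K upperRows lowerRows ⟨
    det K                             ≈⟨ det-fromBlocks-lowerTriangular schur O (λ b a → - M b a) (λ b b′ → y * δ b b′) (λ _ _ → refl) ⟩
    det schur * det (λ (b b′ : Fin n) → y * δ b b′) ≈⟨ *-congˡ (det-diagonal (λ (_ : Fin n) → y)) ⟩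
    det schur * Π (λ (_ : Fin n) → y) ≈⟨ *-comm _ _ ⟩
    Π (λ (_ : Fin n) → y) * det schur ≈⟨ det-scaleRows (λ _ → y) schur ⟨
    det (λ a a′ → y * schur a a′)     ≈⟨ det-cong scaled ⟩
    charPoly (M · M) (x * y)          ∎
    where
    schur : Matrix n
    schur a a′ = x * δ a a′ - y⁻¹ * (M · M) a a′
    K : Matrix (n ℕ.+ n)
    K = fromBlocks schur O (λ b a → - M b a) (λ b b′ → y * δ b b′)

    Σ-scaledδ : ∀ a b′ → Σ (λ b → y⁻¹ * M a b * (y * δ b b′)) ≈ M a b′
    Σ-scaledδ a b′ = begin
      Σ (λ b → y⁻¹ * M a b * (y * δ b b′))
        ≈⟨ Σ-cong (λ b → solve 4 (λ i m y d → i :* m :* (y :* d) := i :* m :* y :* d) refl y⁻¹ (M a b) y (δ b b′)) ⟩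
      Σ (λ b → y⁻¹ * M a b * y * δ b b′)   ≈⟨ Σ-δʳ b′ (λ b → y⁻¹ * M a b * y) ⟩
      y⁻¹ * M a b′ * y                     ≈⟨ solve 3 (λ i m y → i :* m :* y := (y :* i) :* m) refl y⁻¹ (M a b′) y ⟩
      (y * y⁻¹) * M a b′                   ≈⟨ trans (*-congʳ yy⁻¹≈1) (*-identityˡ _) ⟩
      M a b′                               ∎

    upperRows : ∀ a j → K (a ↑ˡ n) j ≈ crossBlock x y M (a ↑ˡ n) j + Σ (λ b → y⁻¹ * M a b * crossBlock x y M (n ↑ʳ b) j)
    upperRows a j with blockIndex n j
    ... | upper a′ = begin
      K (a ↑ˡ n) (a′ ↑ˡ n)                                        ≈⟨ reflexive (fromBlocks-ˡˡ schur O _ _ a a′) ⟩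
      x * δ a a′ + - (y⁻¹ * Σ (λ b → M a b * M b a′))             ≈⟨ +-congˡ (-‿cong (Σ-*ˡ y⁻¹ (λ b → M a b * M b a′))) ⟨
      x * δ a a′ + - Σ (λ b → y⁻¹ * (M a b * M b a′))             ≈⟨ +-congˡ (Σ-neg (λ b → y⁻¹ * (M a b * M b a′))) ⟨
      x * δ a a′ + Σ (λ b → - (y⁻¹ * (M a b * M b a′)))
        ≈⟨ +-cong (sym (crossBlock-ˡˡ x y M a a′))
                  (Σ-cong (λ b → trans (solve 3 (λ i m m′ → :- (i :* (m :* m′)) := i :* m :* (:- m′)) refl y⁻¹ (M a b) (M b a′))
                                       (*-congˡ (sym (crossBlock-ʳˡ x y M b a′))))) ⟩
      crossBlock x y M (a ↑ˡ n) (a′ ↑ˡ n) + Σ (λ b → y⁻¹ * M a b * crossBlock x y M (n ↑ʳ b) (a′ ↑ˡ n)) ∎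
    ... | lower b′ = begin
      K (a ↑ˡ n) (n ↑ʳ b′)                                        ≈⟨ reflexive (fromBlocks-ˡʳ schur O _ _ a b′) ⟩
      0#                                                          ≈⟨ -‿inverseˡ (M a b′) ⟨
      - M a b′ + M a b′
        ≈⟨ +-cong (sym (crossBlock-ˡʳ x y M a b′))
                  (trans (sym (Σ-scaledδ a b′)) (Σ-cong (λ b → *-congˡ (sym (crossBlock-ʳʳ x y M b b′))))) ⟩
      crossBlock x y M (a ↑ˡ n) (n ↑ʳ b′) + Σ (λ b → y⁻¹ * M a b * crossBlock x y M (n ↑ʳ b) (n ↑ʳ b′)) ∎

    lowerRows : ∀ b j → K (n ↑ʳ b) j ≈ crossBlock x y M (n ↑ʳ b) j
    lowerRows b j with blockIndex n j
    ... | upper a = trans (reflexive (fromBlocks-ʳˡ schur O _ _ b a)) (sym (crossBlock-ʳˡ x y M b a))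
    ... | lower b′ = trans (reflexive (fromBlocks-ʳʳ schur O _ _ b b′)) (sym (crossBlock-ʳʳ x y M b b′))

    scaled : ∀ a a′ → y * schur a a′ ≈ charMat (x * y) (M · M) a a′
    scaled a a′ = trans (solve 5 (λ x y i d m → y :* (x :* d :- i :* m) := (x :* y) :* d :- (y :* i) :* m)
                               refl x y y⁻¹ (δ a a′) ((M · M) a a′))
                        (+-congˡ (-‿cong (trans (*-congʳ yy⁻¹≈1) (*-identityˡ _))))

  -- Adding the lower rows to the upper ones and then subtracting the left
  -- columns from the right ones makes the matrix block lower triangular.
  det-crossBlock-factor : ∀ {n} (M : Matrix n) t →
    det (crossBlock t t M) ≈ charPoly M t * det (λ a a′ → t * δ a a′ + M a a′)
  det-crossBlock-factor {n} M t = begin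
    det (crossBlock t t M) ≈⟨ det-addToUpperRows n δ (crossBlock t t M) K₁ upperRows lowerRows ⟨
    det K₁                 ≈⟨ det-addToRightColumns n (λ a b → - δ a b) K₁ K₂ leftColumns rightColumns ⟨
    det K₂                 ≈⟨ det-fromBlocks-lowerTriangular (charMat t M) O (λ b a → - M b a) plus (λ _ _ → refl) ⟩
    charPoly M t * det plus ∎
    where
    plus : Matrix n
    plus a a′ = t * δ a a′ + M a a′
    K₁ K₂ : Matrix (n ℕ.+ n)
    K₁ = fromBlocks (charMat t M) (charMat t M) (λ b a → - M b a) (λ b b′ → t * δ b b′)
    K₂ = fromBlocks (charMat t M) O (λ b a → - M b a) plus

    upperRows : ∀ a j → K₁ (a ↑ˡ n) j ≈ crossBlock t t M (a ↑ˡ n) j + Σ (λ b → δ a b * crossBlock t t M (n ↑ʳ b) j)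
    upperRows a j = trans (upperRow j) (+-congˡ (sym (Σ-δˡ a (λ b → crossBlock t t M (n ↑ʳ b) j))))
      where
      upperRow : ∀ j → K₁ (a ↑ˡ n) j ≈ crossBlock t t M (a ↑ˡ n) j + crossBlock t t M (n ↑ʳ a) j
      upperRow j with blockIndex n j
      ... | upper a′ = trans (reflexive (fromBlocks-ˡˡ (charMat t M) _ _ _ a a′))
                             (sym (+-cong (crossBlock-ˡˡ t t M a a′) (crossBlock-ʳˡ t t M a a′)))
      ... | lower b′ = trans (reflexive (fromBlocks-ˡʳ _ (charMat t M) _ _ a b′))
                             (trans (+-comm _ _) (sym (+-cong (crossBlock-ˡʳ t t M a b′) (crossBlock-ʳʳ t t M a b′))))

    lowerRows : ∀ b j → K₁ (n ↑ʳ b) j ≈ crossBlock t t M (n ↑ʳ b) j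
    lowerRows b j with blockIndex n j
    ... | upper a  = trans (reflexive (fromBlocks-ʳˡ (charMat t M) _ _ _ b a)) (sym (crossBlock-ʳˡ t t M b a))
    ... | lower b′ = trans (reflexive (fromBlocks-ʳʳ (charMat t M) _ _ _ b b′)) (sym (crossBlock-ʳʳ t t M b b′))

    leftColumns : ∀ i a → K₂ i (a ↑ˡ n) ≈ K₁ i (a ↑ˡ n)
    leftColumns i a with blockIndex n i
    ... | upper a′ = reflexive (≡.trans (fromBlocks-ˡˡ (charMat t M) O _ plus a′ a)
                                        (≡.sym (fromBlocks-ˡˡ _ (charMat t M) _ _ a′ a)))
    ... | lower b  = reflexive (≡.trans (fromBlocks-ʳˡ (charMat t M) O _ plus b a) (≡.sym (fromBlocks-ʳˡ _ (charMat t M) _ _ b a)))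

    rightColumns : ∀ i b → K₂ i (n ↑ʳ b) ≈ K₁ i (n ↑ʳ b) + Σ (λ a → K₁ i (a ↑ˡ n) * - δ a b)
    rightColumns i b = trans (rightColumn i) (+-congˡ (sym (Σ-*-negδ (λ a → K₁ i (a ↑ˡ n)))))
      where
      Σ-*-negδ : ∀ (f : Fin n → Carrier) → Σ (λ a → f a * - δ a b) ≈ - f b
      Σ-*-negδ f = begin
        Σ (λ a → f a * - δ a b)   ≈⟨ Σ-cong (λ a → sym (-‿distribʳ-* (f a) (δ a b))) ⟩
        Σ (λ a → - (f a * δ a b)) ≈⟨ Σ-neg (λ a → f a * δ a b) ⟩
        - Σ (λ a → f a * δ a b)   ≈⟨ -‿cong (Σ-δʳ b f) ⟩
        - f b                     ∎
      rightColumn : ∀ i → K₂ i (n ↑ʳ b) ≈ K₁ i (n ↑ʳ b) - K₁ i (b ↑ˡ n)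
      rightColumn i with blockIndex n i
      ... | upper a = begin
        K₂ (a ↑ˡ n) (n ↑ʳ b)                              ≈⟨ reflexive (fromBlocks-ˡʳ (charMat t M) O _ plus a b) ⟩
        0#                                                ≈⟨ -‿inverseʳ _ ⟨
        charMat t M a b - charMat t M a b                 ≈⟨ reflexive (≡.cong₂ _-_ (fromBlocks-ˡʳ _ (charMat t M) _ _ a b)
                                                                                       (fromBlocks-ˡˡ (charMat t M) _ _ _ a b)) ⟨
        K₁ (a ↑ˡ n) (n ↑ʳ b) - K₁ (a ↑ˡ n) (b ↑ˡ n)       ∎
      ... | lower b′ = begin
        K₂ (n ↑ʳ b′) (n ↑ʳ b)                             ≈⟨ reflexive (fromBlocks-ʳʳ (charMat t M) O _ plus b′ b) ⟩
        t * δ b′ b + M b′ b                               ≈⟨ +-congˡ (-‿involutive _) ⟨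
        t * δ b′ b - - M b′ b                             ≈⟨ reflexive (≡.cong₂ _-_ (fromBlocks-ʳʳ (charMat t M) _ _ _ b′ b)
                                                                                       (fromBlocks-ʳˡ (charMat t M) _ _ _ b′ b)) ⟨
        K₁ (n ↑ʳ b′) (n ↑ʳ b) - K₁ (n ↑ʳ b′) (b ↑ˡ n)     ∎

  det-scalar+ : ∀ {n} {M : Matrix n} {λs} → IsEigenvalues M λs → ∀ t →
           det (λ a a′ → t * δ a a′ + M a a′) ≈ Π (λ i → t + λs i)
  det-scalar+ {n} {M} {λs} eigen t = begin
    det (λ a a′ → t * δ a a′ + M a a′)
      ≈⟨ det-cong (λ a a′ → trans (solve 3 (λ t d m → t :* d :+ m := :- ((:- t) :* d :- m)) refl t (δ a a′) (M a a′))
                                  (sym (-1*x≈-x _))) ⟩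
    det (λ a a′ → - 1# * charMat (- t) M a a′)  ≈⟨ det-scaleRows (λ _ → - 1#) (charMat (- t) M) ⟩
    Π (λ (_ : Fin n) → - 1#) * charPoly M (- t) ≈⟨ *-congˡ (eigen (- t)) ⟩
    Π (λ (_ : Fin n) → - 1#) * Π (λ i → - t - λs i) ≈⟨ Π-distrib-* (λ _ → - 1#) (λ i → - t - λs i) ⟨
    Π (λ i → - 1# * (- t - λs i))
      ≈⟨ Π-cong (λ i → trans (-1*x≈-x _) (solve 2 (λ t l → :- ((:- t) :- l) := t :+ l) refl t (λs i))) ⟩
    Π (λ i → t + λs i)                          ∎

  -- Schur's formula and the factorisation of the same matrix at x = y = t.
  charPoly-square-at : ∀ {n} {M : Matrix n} {λs} → IsEigenvalues M λs → ∀ t t⁻¹ → t * t⁻¹ ≈ 1# →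
                       charPoly (M · M) (t * t) ≈ Π (λ i → t * t - λs i * λs i)
  charPoly-square-at {n} {M} {λs} eigen t t⁻¹ tt⁻¹≈1 = begin
    charPoly (M · M) (t * t)                    ≈⟨ det-crossBlock-schur M t t t⁻¹ tt⁻¹≈1 ⟨
    det (crossBlock t t M)                      ≈⟨ det-crossBlock-factor M t ⟩
    charPoly M t * det (λ a a′ → t * δ a a′ + M a a′) ≈⟨ *-cong (eigen t) (det-scalar+ {M = M} eigen t) ⟩
    Π (λ i → t - λs i) * Π (λ i → t + λs i)     ≈⟨ Π-distrib-* (λ i → t - λs i) (λ i → t + λs i) ⟨
    Π (λ i → (t - λs i) * (t + λs i))           ≈⟨ Π-cong (λ i → solve 2 (λ t l → (t :- l) :* (t :+ l) := t :* t :- l :* l) refl t (λs i)) ⟩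
    Π (λ i → t * t - λs i * λs i)               ∎

  module WithField (charZeroField : CharZeroField) where
    open CharZeroField charZeroField

    -- Polynomial functions

    Poly : ℕ → Set c
    Poly n = Vec Carrier n

    eval : ∀ {n} → Poly n → Carrier → Carrier
    eval []      s = 0#
    eval (a ∷ p) s = a + s * eval p s

    IsPolynomial : ℕ → (Carrier → Carrier) → Set (c ⊔ ℓ)
    IsPolynomial n f = ∃ λ (p : Poly n) → ∀ s → f s ≈ eval p s

    private
      eval-replicate-0 : ∀ k s → eval (replicate k 0#) s ≈ 0#
      eval-replicate-0 zero    s = refl
      eval-replicate-0 (suc k) s = trans (+-congˡ (trans (*-congˡ (eval-replicate-0 k s)) (zeroʳ s))) (+-identityʳ 0#)

      eval-++-0 : ∀ {n} k (p : Poly n) s → eval (p ++ replicate k 0#) s ≈ eval p s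
      eval-++-0 k []      s = eval-replicate-0 k s
      eval-++-0 k (a ∷ p) s = +-congˡ (*-congˡ (eval-++-0 k p s))

      eval-∷ʳ-0 : ∀ {n} (p : Poly n) s → eval (p ∷ʳ 0#) s ≈ eval p s
      eval-∷ʳ-0 []      s = eval-replicate-0 1 s
      eval-∷ʳ-0 (a ∷ p) s = +-congˡ (*-congˡ (eval-∷ʳ-0 p s))

      _+ᴾ_ : ∀ {n} → Poly n → Poly n → Poly n
      []      +ᴾ []      = []
      (a ∷ p) +ᴾ (b ∷ q) = (a + b) ∷ (p +ᴾ q)

      eval-+ : ∀ {n} (p q : Poly n) s → eval (p +ᴾ q) s ≈ eval p s + eval q s
      eval-+ []      []      s = sym (+-identityʳ 0#)
      eval-+ (a ∷ p) (b ∷ q) s = trans (+-congˡ (*-congˡ (eval-+ p q s)))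
        (solve 5 (λ a b s x y → (a :+ b) :+ s :* (x :+ y) := (a :+ s :* x) :+ (b :+ s :* y)) refl a b s _ _)

      _·ᴾ_ : ∀ {n} → Carrier → Poly n → Poly n
      a ·ᴾ []      = []
      a ·ᴾ (b ∷ p) = (a * b) ∷ (a ·ᴾ p)

      eval-· : ∀ {n} a (p : Poly n) s → eval (a ·ᴾ p) s ≈ a * eval p s
      eval-· a []      s = sym (zeroʳ a)
      eval-· a (b ∷ p) s = trans (+-congˡ (*-congˡ (eval-· a p s)))
        (solve 4 (λ a b s x → a :* b :+ s :* (a :* x) := a :* (b :+ s :* x)) refl a b s _)

    poly-cong : ∀ {n f g} → (∀ s → f s ≈ g s) → IsPolynomial n f → IsPolynomial n g
    poly-cong f≈g (p , f≈p) = p , λ s → trans (sym (f≈g s)) (f≈p s)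

    poly-0 : ∀ n → IsPolynomial n (λ _ → 0#)
    poly-0 n = replicate n 0# , λ s → sym (eval-replicate-0 n s)

    poly-+ : ∀ {n f g} → IsPolynomial n f → IsPolynomial n g → IsPolynomial n (λ s → f s + g s)
    poly-+ (p , f≈p) (q , g≈q) = p +ᴾ q , λ s → trans (+-cong (f≈p s) (g≈q s)) (sym (eval-+ p q s))

    poly-scale : ∀ {n f} a → IsPolynomial n f → IsPolynomial n (λ s → a * f s)
    poly-scale a (p , f≈p) = a ·ᴾ p , λ s → trans (*-congˡ (f≈p s)) (sym (eval-· a p s))

    poly-weaken : ∀ {n f} k → IsPolynomial n f → IsPolynomial (n ℕ.+ k) f
    poly-weaken k (p , f≈p) = p ++ replicate k 0# , λ s → trans (f≈p s) (sym (eval-++-0 k p s))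

    poly-linear-* : ∀ {n f} a b → IsPolynomial n f → IsPolynomial (suc n) (λ s → (a + b * s) * f s)
    poly-linear-* {f = f} a b (p , f≈p) = (a ·ᴾ p ∷ʳ 0#) +ᴾ (0# ∷ b ·ᴾ p) , λ s → begin
      (a + b * s) * f s                             ≈⟨ *-congˡ (f≈p s) ⟩
      (a + b * s) * eval p s                        ≈⟨ solve 4 (λ a b s x → (a :+ b :* s) :* x := a :* x :+ s :* (b :* x))
                                                              refl a b s (eval p s) ⟩
      a * eval p s + s * (b * eval p s)             ≈⟨ +-cong (trans (sym (eval-· a p s)) (sym (eval-∷ʳ-0 (a ·ᴾ p) s)))
                                                              (trans (*-congˡ (sym (eval-· b p s))) (sym (+-identityˡ _))) ⟩
      eval (a ·ᴾ p ∷ʳ 0#) s + eval (0# ∷ b ·ᴾ p) s  ≈⟨ eval-+ (a ·ᴾ p ∷ʳ 0#) (0# ∷ b ·ᴾ p) s ⟨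
      eval ((a ·ᴾ p ∷ʳ 0#) +ᴾ (0# ∷ b ·ᴾ p)) s      ∎

    poly-Σ : ∀ {m n} {f : Fin m → Carrier → Carrier} → (∀ i → IsPolynomial n (f i)) →
             IsPolynomial n (λ s → Σ (λ i → f i s))
    poly-Σ {zero}  {n} _     = poly-0 n
    poly-Σ {suc m} f-poly = poly-+ (f-poly zero) (poly-Σ (f-poly ∘ suc))

    poly-Π : ∀ {m} (a b : Fin m → Carrier) → IsPolynomial (suc m) (λ s → Π (λ i → a i + b i * s))
    poly-Π {zero}  a b = 1# ∷ [] , λ s → sym (trans (+-congˡ (zeroʳ s)) (+-identityʳ 1#))
    poly-Π {suc m} a b = poly-linear-* (a zero) (b zero) (poly-Π (a ∘ suc) (b ∘ suc))

    poly-det : ∀ {n} (P Q : Matrix n) → IsPolynomial (suc n) (λ s → det (λ i j → P i j + Q i j * s))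
    poly-det {zero}  P Q = 1# ∷ [] , λ s → sym (trans (+-congˡ (zeroʳ s)) (+-identityʳ 1#))
    poly-det {suc n} P Q = poly-Σ (λ j → poly-cong (λ s → sym (*-assoc _ _ _))
      (poly-scale (alt j) (poly-linear-* (P zero j) (Q zero j) (poly-det (minor j P) (minor j Q)))))

    poly-difference : ∀ {n f g} → IsPolynomial n f → IsPolynomial n g → IsPolynomial n (λ s → f s - g s)
    poly-difference f-poly g-poly = poly-cong (λ s → +-congˡ (-1*x≈-x _)) (poly-+ f-poly (poly-scale (- 1#) g-poly))

    private
      divide : ∀ {n} → Poly (suc n) → Carrier → Poly n
      divide {zero}  (a ∷ []) r = []
      divide {suc n} (a ∷ p)  r = eval p r ∷ divide p r

      eval-divide : ∀ {n} (p : Poly (suc n)) r s → eval p s ≈ (s - r) * eval (divide p r) s + eval p r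
      eval-divide {zero} (a ∷ []) r s = begin
        a + s * 0#                      ≈⟨ trans (+-congˡ (zeroʳ s)) (+-identityʳ a) ⟩
        a                               ≈⟨ trans (+-cong (zeroʳ _) (trans (+-congˡ (zeroʳ r)) (+-identityʳ a))) (+-identityˡ a) ⟨
        (s - r) * 0# + (a + r * 0#)     ∎
      eval-divide {suc n} (a ∷ p) r s = begin
        a + s * eval p s
          ≈⟨ +-congˡ (*-congˡ (eval-divide p r s)) ⟩
        a + s * ((s - r) * eval (divide p r) s + eval p r)
          ≈⟨ solve 5 (λ a s r q e → a :+ s :* ((s :- r) :* q :+ e) := (s :- r) :* (e :+ s :* q) :+ (a :+ r :* e))
                   refl a s r _ _ ⟩
        (s - r) * (eval p r + s * eval (divide p r) s) + (a + r * eval p r) ∎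

      *-cancel-≉0 : ∀ {a b} → ¬ a ≈ 0# → a * b ≈ 0# → b ≈ 0#
      *-cancel-≉0 {a} {b} a≉0 ab≈0 with inverse a a≉0
      ... | a⁻¹ , aa⁻¹≈1 = begin
        b               ≈⟨ *-identityˡ b ⟨
        1# * b          ≈⟨ *-congʳ aa⁻¹≈1 ⟨
        (a * a⁻¹) * b   ≈⟨ solve 3 (λ a a⁻¹ b → (a :* a⁻¹) :* b := a⁻¹ :* (a :* b)) refl a a⁻¹ b ⟩
        a⁻¹ * (a * b)   ≈⟨ *-congˡ ab≈0 ⟩
        a⁻¹ * 0#        ≈⟨ zeroʳ a⁻¹ ⟩
        0#              ∎

      -- Dividing by s - r₀ leaves a polynomial vanishing at the remaining points.
      vanishing : ∀ {n} (p : Poly n) (r : Fin n → Carrier) → (∀ {i j} → r i ≈ r j → i ≡ j) →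
                  (∀ i → eval p (r i) ≈ 0#) → ∀ s → eval p s ≈ 0#
      vanishing {zero}  []  r r-inj p≈0 s = refl
      vanishing {suc n} p r r-inj p≈0 s = begin
        eval p s                                  ≈⟨ eval-divide p (r zero) s ⟩
        (s - r zero) * eval q s + eval p (r zero) ≈⟨ +-cong (trans (*-congˡ (vanishing q (r ∘ suc) (Fin.suc-injective ∘ r-inj) q≈0 s))
                                                                   (zeroʳ _))
                                                            (p≈0 zero) ⟩
        0# + 0#                                   ≈⟨ +-identityʳ 0# ⟩
        0#                                        ∎
        where
        q = divide p (r zero)
        q≈0 : ∀ i → eval q (r (suc i)) ≈ 0#
        q≈0 i = *-cancel-≉0 (λ d≈0 → Fin.0≢1+n (≡.sym (r-inj (x∙y⁻¹≈ε⇒x≈y _ _ d≈0)))) (begin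
          (r (suc i) - r zero) * eval q (r (suc i))                    ≈⟨ +-identityʳ _ ⟨
          (r (suc i) - r zero) * eval q (r (suc i)) + 0#               ≈⟨ +-congˡ (p≈0 zero) ⟨
          (r (suc i) - r zero) * eval q (r (suc i)) + eval p (r zero)  ≈⟨ eval-divide p (r zero) (r (suc i)) ⟨
          eval p (r (suc i))                                           ≈⟨ p≈0 (suc i) ⟩
          0#                                                           ∎)

    polynomial-identity : ∀ {n f g} → IsPolynomial n f → IsPolynomial n g → (r : Fin n → Carrier) →
                          (∀ {i j} → r i ≈ r j → i ≡ j) → (∀ i → f (r i) ≈ g (r i)) → ∀ s → f s ≈ g s
    polynomial-identity f-poly g-poly r r-inj f≈g s with poly-difference f-poly g-poly
    ... | d , f-g≈d = x∙y⁻¹≈ε⇒x≈y _ _ (trans (f-g≈d s)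
                        (vanishing d r r-inj (λ i → trans (sym (f-g≈d (r i))) (x≈y⇒x∙y⁻¹≈ε (f≈g i))) s))

    private
      natCast-≤-injective : ∀ {a b} → a ℕ.≤ b → natCast b ≈ natCast a → b ≡ a
      natCast-≤-injective {a} {b} a≤b b≈a = ≡.trans (≡.sym (ℕ.m+[n∸m]≡n a≤b))
                                                    (≡.trans (≡.cong (a ℕ.+_) d≡0) (ℕ.+-identityʳ a))
        where
        d≡0 : b ℕ.∸ a ≡ 0
        d≡0 = charZero (b ℕ.∸ a) (+-cancelˡ (natCast a) _ _ (begin
          natCast a + natCast (b ℕ.∸ a) ≈⟨ natCast-+ a (b ℕ.∸ a) ⟨
          natCast (a ℕ.+ (b ℕ.∸ a))     ≈⟨ reflexive (≡.cong natCast (ℕ.m+[n∸m]≡n a≤b)) ⟩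
          natCast b                     ≈⟨ b≈a ⟩
          natCast a                     ≈⟨ +-identityʳ _ ⟨
          natCast a + 0#                ∎))

    natCast-injective : ∀ {a b} → natCast a ≈ natCast b → a ≡ b
    natCast-injective {a} {b} a≈b with ℕ.≤-total a b
    ... | inj₁ a≤b = ≡.sym (natCast-≤-injective a≤b (sym a≈b))
    ... | inj₂ b≤a = natCast-≤-injective b≤a a≈b

    point : ∀ {n} → Fin n → Carrier
    point k = natCast (suc (toℕ k))

    point-invertible : ∀ {n} (k : Fin n) → ∃ λ t⁻¹ → point k * t⁻¹ ≈ 1#
    point-invertible k = inverse (point k) (ℕ.1+n≢0 ∘ charZero (suc (toℕ k)))

    point-injective : ∀ {n} {k l : Fin n} → point k ≈ point l → k ≡ l
    point-injective = Fin.toℕ-injective ∘ ℕ.suc-injective ∘ natCast-injective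

    point²-injective : ∀ {n} {k l : Fin n} → point k * point k ≈ point l * point l → k ≡ l
    point²-injective {k = k} {l} k²≈l² = Fin.toℕ-injective (ℕ.suc-injective (square-injective (natCast-injective (begin
      natCast (suc (toℕ k) ℕ.* suc (toℕ k)) ≈⟨ natCast-* (suc (toℕ k)) (suc (toℕ k)) ⟩
      point k * point k                     ≈⟨ k²≈l² ⟩
      point l * point l                     ≈⟨ natCast-* (suc (toℕ l)) (suc (toℕ l)) ⟨
      natCast (suc (toℕ l) ℕ.* suc (toℕ l)) ∎))))

    eigenvalues-square : ∀ {n} {M : Matrix n} {λs} → IsEigenvalues M λs → IsEigenvalues (M · M) (λ i → λs i * λs i)
    eigenvalues-square {n} {M} {λs} eigen = polynomial-identity charPoly-poly product-poly
      (λ k → point k * point k) point²-injective atSquare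
      where
      charPoly-poly : IsPolynomial (suc n) (charPoly (M · M))
      charPoly-poly = poly-cong (λ z → det-cong (λ i j → trans (+-comm (- (M · M) i j) (δ i j * z)) (+-congʳ (*-comm (δ i j) z))))
                                (poly-det (λ i j → - (M · M) i j) δ)
      product-poly : IsPolynomial (suc n) (λ z → Π (λ i → z - λs i * λs i))
      product-poly = poly-cong (λ z → Π-cong (λ i → trans (+-comm (- (λs i * λs i)) (1# * z)) (+-congʳ (*-identityˡ z))))
                               (poly-Π (λ i → - (λs i * λs i)) (λ _ → 1#))
      atSquare : ∀ k → charPoly (M · M) (point k * point k) ≈ Π (λ i → point k * point k - λs i * λs i)
      atSquare k = charPoly-square-at {M = M} eigen (point k) _ (proj₂ (point-invertible k))

    det-crossBlock : ∀ {n} {M : Matrix n} {λs} → IsEigenvalues M λs →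
                     ∀ x y → det (crossBlock x y M) ≈ Π (λ i → x * y - λs i * λs i)
    det-crossBlock {n} {M} {λs} eigen x = polynomial-identity det-poly product-poly point point-injective atPoint
      where
      E : Matrix (n ℕ.+ n)
      E = fromBlocks {n} O O O δ

      linearInY : ∀ y i j → crossBlock x 0# M i j + E i j * y ≈ crossBlock x y M i j
      linearInY y i j with blockIndex n i | blockIndex n j
      ... | upper a | upper a′ = begin
        crossBlock x 0# M (a ↑ˡ n) (a′ ↑ˡ n) + E (a ↑ˡ n) (a′ ↑ˡ n) * y
          ≈⟨ +-cong (crossBlock-ˡˡ x 0# M a a′) (*-congʳ (reflexive (fromBlocks-ˡˡ (O {n} {n}) O O δ a a′))) ⟩
        x * δ a a′ + 0# * y ≈⟨ trans (+-congˡ (zeroˡ y)) (+-identityʳ _) ⟩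
        x * δ a a′          ≈⟨ crossBlock-ˡˡ x y M a a′ ⟨
        crossBlock x y M (a ↑ˡ n) (a′ ↑ˡ n) ∎
      ... | upper a | lower b′ = begin
        crossBlock x 0# M (a ↑ˡ n) (n ↑ʳ b′) + E (a ↑ˡ n) (n ↑ʳ b′) * y
          ≈⟨ +-cong (crossBlock-ˡʳ x 0# M a b′) (*-congʳ (reflexive (fromBlocks-ˡʳ (O {n} {n}) O O δ a b′))) ⟩
        - M a b′ + 0# * y   ≈⟨ trans (+-congˡ (zeroˡ y)) (+-identityʳ _) ⟩
        - M a b′            ≈⟨ crossBlock-ˡʳ x y M a b′ ⟨
        crossBlock x y M (a ↑ˡ n) (n ↑ʳ b′) ∎
      ... | lower b | upper a′ = begin
        crossBlock x 0# M (n ↑ʳ b) (a′ ↑ˡ n) + E (n ↑ʳ b) (a′ ↑ˡ n) * y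
          ≈⟨ +-cong (crossBlock-ʳˡ x 0# M b a′) (*-congʳ (reflexive (fromBlocks-ʳˡ (O {n} {n}) O O δ b a′))) ⟩
        - M b a′ + 0# * y   ≈⟨ trans (+-congˡ (zeroˡ y)) (+-identityʳ _) ⟩
        - M b a′            ≈⟨ crossBlock-ʳˡ x y M b a′ ⟨
        crossBlock x y M (n ↑ʳ b) (a′ ↑ˡ n) ∎
      ... | lower b | lower b′ = begin
        crossBlock x 0# M (n ↑ʳ b) (n ↑ʳ b′) + E (n ↑ʳ b) (n ↑ʳ b′) * y
          ≈⟨ +-cong (crossBlock-ʳʳ x 0# M b b′) (*-congʳ (reflexive (fromBlocks-ʳʳ (O {n} {n}) O O δ b b′))) ⟩
        0# * δ b b′ + δ b b′ * y ≈⟨ trans (+-cong (zeroˡ _) (*-comm _ _)) (+-identityˡ _) ⟩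
        y * δ b b′               ≈⟨ crossBlock-ʳʳ x y M b b′ ⟨
        crossBlock x y M (n ↑ʳ b) (n ↑ʳ b′) ∎

      det-poly : IsPolynomial (suc (n ℕ.+ n)) (λ y → det (crossBlock x y M))
      det-poly = poly-cong (λ y → det-cong (linearInY y)) (poly-det (crossBlock x 0# M) E)

      product-poly : IsPolynomial (suc (n ℕ.+ n)) (λ y → Π (λ i → x * y - λs i * λs i))
      product-poly = poly-weaken n (poly-cong (λ y → Π-cong (λ i → +-comm (- (λs i * λs i)) (x * y)))
                                              (poly-Π (λ i → - (λs i * λs i)) (λ _ → x)))

      atPoint : ∀ k → det (crossBlock x (point k) M) ≈ Π (λ i → x * point k - λs i * λs i)
      atPoint k = trans (det-crossBlock-schur M x (point k) _ (proj₂ (point-invertible k)))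
                        (eigenvalues-square {M = M} eigen (x * point k))

  -- The duplication corona

  signK-* : ∀ s t → signK (s Sign.* t) ≈ signK s * signK t
  signK-* Sign.+ Sign.+ = sym (*-identityˡ 1#)
  signK-* Sign.+ Sign.- = sym (*-identityˡ _)
  signK-* Sign.- Sign.+ = sym (*-identityʳ _)
  signK-* Sign.- Sign.- = trans (sym (-‿involutive 1#)) (trans (-‿cong (sym (*-identityˡ (- 1#)))) (-‿distribˡ-* 1# (- 1#)))

  signK-square : ∀ s → signK s * signK s ≈ 1#
  signK-square s = trans (sym (signK-* s s)) (reflexive (≡.cong signK (SignP.s*s≡+ s)))

  entry-guard : ∀ {n} (a i : Fin n) e → entry (guard (a Fin.≟ i) e) ≈ δ a i * entry e
  entry-guard a i e with a Fin.≟ i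
  ... | yes _ = sym (*-identityˡ _)
  ... | no _  = sym (zeroˡ _)

  δ-combine : ∀ {m k} (i j : Fin m) (l l′ : Fin k) → δ (combine i l) (combine j l′) ≈ δ i j * δ l l′
  δ-combine i j l l′ with i Fin.≟ j | l Fin.≟ l′
  ... | yes ≡.refl | yes ≡.refl = trans (δ-refl (combine i l)) (sym (*-identityˡ 1#))
  ... | no i≢j     | _          = trans (δ-≢ (i≢j ∘ proj₁ ∘ Fin.combine-injective i l j l′)) (sym (zeroˡ _))
  ... | yes _      | no l≢l′    = trans (δ-≢ (l≢l′ ∘ proj₂ ∘ Fin.combine-injective i l j l′)) (sym (zeroʳ _))

  module Corona {n₁ n₂} (Γ₁ : SignedGraph n₁) (Γ₂ : SignedGraph n₂) where
    open CoronaEdges Γ₁ Γ₂ using (cEdge; av)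

    k : ℕ
    k = n₁ ℕ.* n₂

    -- The vertex order of corona, with the index set reassociated as
    -- (n₁ + n₁) + n₁ n₂ to separate the u and a vertices from the copies of Γ₂.
    index : CVertex n₁ n₂ → Fin ((n₁ ℕ.+ n₁) ℕ.+ k)
    index (U u)   = (u ↑ˡ n₁) ↑ˡ k
    index (A a)   = (n₁ ↑ʳ a) ↑ˡ k
    index (C i l) = (n₁ ℕ.+ n₁) ↑ʳ combine i l

    reassoc : Fin ((n₁ ℕ.+ n₁) ℕ.+ k) → Fin (n₁ ℕ.+ (n₁ ℕ.+ k))
    reassoc = Fin.cast (ℕ.+-assoc n₁ n₁ k)

    reassoc-injective : ∀ {i j} → reassoc i ≡ reassoc j → i ≡ j
    reassoc-injective {i} {j} eq = ≡.trans (≡.sym (Fin.cast-involutive (≡.sym assoc) assoc i))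
                                           (≡.trans (≡.cong (Fin.cast (≡.sym assoc)) eq) (Fin.cast-involutive (≡.sym assoc) assoc j))
      where assoc = ℕ.+-assoc n₁ n₁ k

    private
      cast-↑ˡ↑ˡ : ∀ {a b c} (i : Fin a) → Fin.cast (ℕ.+-assoc a b c) ((i ↑ˡ b) ↑ˡ c) ≡ i ↑ˡ (b ℕ.+ c)
      cast-↑ˡ↑ˡ zero    = ≡.refl
      cast-↑ˡ↑ˡ (suc i) = ≡.cong suc (cast-↑ˡ↑ˡ i)

      cast-↑ʳ↑ˡ : ∀ a {b c} (i : Fin b) → Fin.cast (ℕ.+-assoc a b c) ((a ↑ʳ i) ↑ˡ c) ≡ a ↑ʳ (i ↑ˡ c)
      cast-↑ʳ↑ˡ zero    i = Fin.cast-is-id _ _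
      cast-↑ʳ↑ˡ (suc a) i = ≡.cong suc (cast-↑ʳ↑ˡ a i)

      cast-↑ʳ : ∀ a {b c} (i : Fin c) → Fin.cast (ℕ.+-assoc a b c) ((a ℕ.+ b) ↑ʳ i) ≡ a ↑ʳ (b ↑ʳ i)
      cast-↑ʳ zero    i = Fin.cast-is-id _ _
      cast-↑ʳ (suc a) i = ≡.cong suc (cast-↑ʳ a i)

    decode-index : ∀ v → decode n₁ n₂ (reassoc (index v)) ≡ v
    decode-index (U u) rewrite cast-↑ˡ↑ˡ {b = n₁} {k} u | Fin.splitAt-↑ˡ n₁ u (n₁ ℕ.+ k) = ≡.refl
    decode-index (A a) rewrite cast-↑ʳ↑ˡ n₁ {c = k} a | Fin.splitAt-↑ʳ n₁ (n₁ ℕ.+ k) (a ↑ˡ k)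
                             | Fin.splitAt-↑ˡ n₁ a k = ≡.refl
    decode-index (C i l) rewrite cast-↑ʳ n₁ {n₁} (combine i l) | Fin.splitAt-↑ʳ n₁ (n₁ ℕ.+ k) (n₁ ↑ʳ combine i l)
                               | Fin.splitAt-↑ʳ n₁ k (combine i l) = ≡.cong (uncurry C) (Fin.remQuot-combine i l)

    index-injective : ∀ {v w} → index v ≡ index w → v ≡ w
    index-injective {v} {w} eq =
      ≡.trans (≡.sym (decode-index v)) (≡.trans (≡.cong (decode n₁ n₂ ∘ reassoc) eq) (decode-index w))

    δ-index-≢ : ∀ {v w} → v ≢ w → δ (index v) (index w) ≈ 0#
    δ-index-≢ v≢w = δ-≢ (v≢w ∘ index-injective)

    data VertexIndex : Fin ((n₁ ℕ.+ n₁) ℕ.+ k) → Set where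
      vertex : ∀ v → VertexIndex (index v)

    vertexIndex : ∀ j → VertexIndex j
    vertexIndex j with blockIndex (n₁ ℕ.+ n₁) j
    ... | lower p = ≡.subst VertexIndex (≡.cong ((n₁ ℕ.+ n₁) ↑ʳ_) (Fin.combine-remQuot {n₁} n₂ p))
                            (vertex (C (Fin.quotient n₂ p) (Fin.remainder {n₁} n₂ p)))
    ... | upper i with blockIndex n₁ i
    ...   | upper u = vertex (U u)
    ...   | lower a = vertex (A a)

    Mμ : Matrix n₁
    Mμ = adjMat (muGraph Γ₁)

    A₂ : Matrix n₂
    A₂ = adjMat Γ₂

    μ₁ : Fin n₁ → Carrier
    μ₁ = markVec Γ₁

    μ₂ : Fin n₂ → Carrier
    μ₂ = markVec Γ₂

    Mμ-sym : ∀ a u → Mμ a u ≈ Mμ u a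
    Mμ-sym a u = reflexive (≡.cong entry (edge-sym (muGraph Γ₁) a u))

    entry-av : ∀ a i l → entry (av a i l) ≈ δ a i * (μ₁ a * μ₂ l)
    entry-av a i l = trans (entry-guard a i _) (*-congˡ (signK-* (marking Γ₁ a) (marking Γ₂ l)))

    module CharMatrix (x : Carrier) where

      N : Matrix ((n₁ ℕ.+ n₁) ℕ.+ k)
      N i j = charMat x (adjMat (corona Γ₁ Γ₂)) (reassoc i) (reassoc j)

      det-N : det N ≈ charPoly (adjMat (corona Γ₁ Γ₂)) x
      det-N = det-cast (ℕ.+-assoc n₁ n₁ k) (charMat x (adjMat (corona Γ₁ Γ₂)))

      N-entry : ∀ v w → N (index v) (index w) ≈ x * δ (index v) (index w) - entry (cEdge v w)
      N-entry v w = +-cong (*-congˡ (δ-injective reassoc-injective (index v) (index w)))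
                           (-‿cong (reflexive (≡.cong₂ (λ v w → entry (cEdge v w)) (decode-index v) (decode-index w))))

      N-≢ : ∀ v w → v ≢ w → N (index v) (index w) ≈ - entry (cEdge v w)
      N-≢ v w v≢w = trans (N-entry v w) (trans (+-congʳ (trans (*-congˡ (δ-index-≢ v≢w)) (zeroʳ x))) (+-identityˡ _))

      N-UU : ∀ u v → N (index (U u)) (index (U v)) ≈ x * δ u v
      N-UU u v = trans (N-entry (U u) (U v))
                       (trans (+-congˡ -0#≈0#) (trans (+-identityʳ _) (*-congˡ (δ-injective (U-injective ∘ index-injective) u v))))
        where
        U-injective : ∀ {u v} → U {n₂ = n₂} u ≡ U v → u ≡ v
        U-injective ≡.refl = ≡.refl

      N-UA : ∀ u a → N (index (U u)) (index (A a)) ≈ - Mμ a u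
      N-UA u a = N-≢ (U u) (A a) λ ()

      N-UC : ∀ u i l → N (index (U u)) (index (C i l)) ≈ 0#
      N-UC u i l = trans (N-≢ (U u) (C i l) λ ()) -0#≈0#

      N-AU : ∀ a u → N (index (A a)) (index (U u)) ≈ - Mμ a u
      N-AU a u = N-≢ (A a) (U u) λ ()

      N-AA : ∀ a b → N (index (A a)) (index (A b)) ≈ x * δ a b
      N-AA a b = trans (N-entry (A a) (A b))
                       (trans (+-congˡ -0#≈0#) (trans (+-identityʳ _) (*-congˡ (δ-injective (A-injective ∘ index-injective) a b))))
        where
        A-injective : ∀ {a b} → A {n₂ = n₂} a ≡ A b → a ≡ b
        A-injective ≡.refl = ≡.refl

      N-AC : ∀ a i l → N (index (A a)) (index (C i l)) ≈ - (δ a i * (μ₁ a * μ₂ l))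
      N-AC a i l = trans (N-≢ (A a) (C i l) λ ()) (-‿cong (entry-av a i l))

      N-CU : ∀ i l u → N (index (C i l)) (index (U u)) ≈ 0#
      N-CU i l u = trans (N-≢ (C i l) (U u) λ ()) -0#≈0#

      N-CA : ∀ i l a → N (index (C i l)) (index (A a)) ≈ - (δ a i * (μ₁ a * μ₂ l))
      N-CA i l a = trans (N-≢ (C i l) (A a) λ ()) (-‿cong (entry-av a i l))

      N-CC : ∀ i l j m → N (index (C i l)) (index (C j m)) ≈ δ i j * charMat x A₂ l m
      N-CC i l j m = begin
        N (index (C i l)) (index (C j m))
          ≈⟨ N-entry (C i l) (C j m) ⟩
        x * δ (index (C i l)) (index (C j m)) - entry (guard (i Fin.≟ j) (edge Γ₂ l m))
          ≈⟨ +-cong (*-congˡ (trans (δ-injective (Fin.↑ʳ-injective (n₁ ℕ.+ n₁) _ _) (combine i l) (combine j m))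
                                   (δ-combine i j l m)))
                    (-‿cong (entry-guard i j _)) ⟩
        x * (δ i j * δ l m) - δ i j * A₂ l m
          ≈⟨ solve 4 (λ x d e a → x :* (d :* e) :- d :* a := d :* (x :* e :- a)) refl x (δ i j) (δ l m) (A₂ l m) ⟩
        δ i j * charMat x A₂ l m ∎

      module Elimination (B : Matrix n₂) (B-inverse : IsInverse (charMat x A₂) B) where

        χ : Carrier
        χ = coronal Γ₂ B

        β : Fin n₂ → Carrier
        β l = Σ (λ l′ → μ₂ l′ * B l′ l)

        β-charMat : ∀ l → Σ (λ l′ → β l′ * charMat x A₂ l′ l) ≈ μ₂ l
        β-charMat l = begin
          Σ (λ l′ → β l′ * charMat x A₂ l′ l)
            ≈⟨ Σ-cong (λ l′ → trans (sym (Σ-*ʳ (charMat x A₂ l′ l) (λ l″ → μ₂ l″ * B l″ l′)))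
                                    (Σ-cong (λ l″ → *-assoc (μ₂ l″) (B l″ l′) (charMat x A₂ l′ l)))) ⟩
          Σ (λ l′ → Σ (λ l″ → μ₂ l″ * (B l″ l′ * charMat x A₂ l′ l)))
            ≈⟨ Σ-comm (λ l′ l″ → μ₂ l″ * (B l″ l′ * charMat x A₂ l′ l)) ⟩
          Σ (λ l″ → Σ (λ l′ → μ₂ l″ * (B l″ l′ * charMat x A₂ l′ l)))
            ≈⟨ Σ-cong (λ l″ → trans (Σ-*ˡ (μ₂ l″) (λ l′ → B l″ l′ * charMat x A₂ l′ l)) (*-congˡ (proj₂ B-inverse l″ l))) ⟩
          Σ (λ l″ → μ₂ l″ * δ l″ l)
            ≈⟨ Σ-δʳ l μ₂ ⟩
          μ₂ l ∎

        β-μ₂ : Σ (λ l → β l * μ₂ l) ≈ χ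
        β-μ₂ = begin
          Σ (λ l → β l * μ₂ l)                         ≈⟨ Σ-cong (λ l → sym (Σ-*ʳ (μ₂ l) (λ l′ → μ₂ l′ * B l′ l))) ⟩
          Σ (λ l → Σ (λ l′ → μ₂ l′ * B l′ l * μ₂ l))   ≈⟨ Σ-comm (λ l l′ → μ₂ l′ * B l′ l * μ₂ l) ⟩
          χ                                            ∎

        -- Row aᵢ receives μ₁(aᵢ) μ(Γ₂)ᵀ (x I - A(Γ₂))⁻¹ times the rows of the
        -- i-th copy of Γ₂, which clears its entries in the columns of the copies.
        W : Fin n₁ → Fin k → Carrier
        W a p = δ a (Fin.quotient n₂ p) * (μ₁ a * β (Fin.remainder {n₁} n₂ p))

        Σ-W : ∀ a (G : Fin k → Carrier) → Σ (λ p → W a p * G p) ≈ Σ (λ l → μ₁ a * β l * G (combine a l))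
        Σ-W a G = begin
          Σ (λ p → W a p * G p)
            ≈⟨ Σ-combine n₁ n₂ (λ p → W a p * G p) ⟩
          Σ (λ i → Σ (λ l → W a (combine {n₁} {n₂} i l) * G (combine i l)))
            ≈⟨ Σ-cong (λ i → trans (Σ-cong (λ l → trans (*-congʳ (reflexive (W-combine i l))) (*-assoc _ _ _)))
                                   (Σ-*ˡ (δ a i) (λ l → μ₁ a * β l * G (combine i l)))) ⟩
          Σ (λ i → δ a i * Σ (λ l → μ₁ a * β l * G (combine {n₁} {n₂} i l)))
            ≈⟨ Σ-δˡ a (λ i → Σ (λ l → μ₁ a * β l * G (combine i l))) ⟩
          Σ (λ l → μ₁ a * β l * G (combine a l)) ∎
          where
          W-combine : ∀ i l → W a (combine i l) ≡ δ a i * (μ₁ a * β l)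
          W-combine i l = ≡.cong (λ (i , l) → δ a i * (μ₁ a * β l)) (Fin.remQuot-combine i l)

        X : Block (n₁ ℕ.+ n₁) k
        X i p = [ (λ _ → 0#) , (λ a → W a p) ]′ (splitAt n₁ i)

        X-U : ∀ u p → X (u ↑ˡ n₁) p ≈ 0#
        X-U u p rewrite Fin.splitAt-↑ˡ n₁ u n₁ = refl

        X-A : ∀ a p → X (n₁ ↑ʳ a) p ≈ W a p
        X-A a p rewrite Fin.splitAt-↑ʳ n₁ n₁ a = refl

        T : Matrix (n₁ ℕ.+ n₁)
        T = crossBlock x (x - χ) Mμ

        BL : Block k (n₁ ℕ.+ n₁)
        BL p i = N ((n₁ ℕ.+ n₁) ↑ʳ p) (i ↑ˡ k)

        BR : Matrix k
        BR p p′ = N ((n₁ ℕ.+ n₁) ↑ʳ p) ((n₁ ℕ.+ n₁) ↑ʳ p′)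

        K : Matrix ((n₁ ℕ.+ n₁) ℕ.+ k)
        K = fromBlocks T O BL BR

        K-T : ∀ i j → K (i ↑ˡ k) (j ↑ˡ k) ≈ T i j
        K-T i j = reflexive (fromBlocks-ˡˡ T O BL BR i j)

        K-O : ∀ i p → K (i ↑ˡ k) ((n₁ ℕ.+ n₁) ↑ʳ p) ≈ 0#
        K-O i p = reflexive (fromBlocks-ˡʳ T O BL BR i p)

        δ-μ₁² : ∀ a b → δ b a * (μ₁ b * μ₁ a) ≈ δ a b
        δ-μ₁² a b with b Fin.≟ a
        ... | yes ≡.refl = trans (*-identityˡ _) (trans (signK-square (marking Γ₁ a)) (sym (δ-refl a)))
        ... | no b≢a     = trans (zeroˡ _) (sym (δ-≢ (b≢a ∘ ≡.sym)))

        rowU : ∀ u j → K (index (U u)) j ≈ N (index (U u)) j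
        rowU u j with vertexIndex j
        ... | vertex (U v)   = trans (K-T _ _) (trans (crossBlock-ˡˡ x (x - χ) Mμ u v) (sym (N-UU u v)))
        ... | vertex (A b)   = trans (K-T _ _) (trans (crossBlock-ˡʳ x (x - χ) Mμ u b)
                                                     (trans (-‿cong (sym (Mμ-sym b u))) (sym (N-UA u b))))
        ... | vertex (C i l) = trans (K-O _ _) (sym (N-UC u i l))

        Σ-copy-A : ∀ a b → Σ (λ l → μ₁ a * β l * N (index (C a l)) (index (A b))) ≈ - (δ a b * χ)
        Σ-copy-A a b = begin
          Σ (λ l → μ₁ a * β l * N (index (C a l)) (index (A b)))
            ≈⟨ Σ-cong (λ l → trans (*-congˡ (N-CA a l b))
                                   (solve 5 (λ s b′ d t u → s :* b′ :* (:- (d :* (t :* u))) := :- (d :* (t :* s) :* (b′ :* u)))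
                                          refl (μ₁ a) (β l) (δ b a) (μ₁ b) (μ₂ l))) ⟩
          Σ (λ l → - (δ b a * (μ₁ b * μ₁ a) * (β l * μ₂ l)))  ≈⟨ Σ-neg (λ l → δ b a * (μ₁ b * μ₁ a) * (β l * μ₂ l)) ⟩
          - Σ (λ l → δ b a * (μ₁ b * μ₁ a) * (β l * μ₂ l))    ≈⟨ -‿cong (Σ-*ˡ (δ b a * (μ₁ b * μ₁ a)) (λ l → β l * μ₂ l)) ⟩
          - (δ b a * (μ₁ b * μ₁ a) * Σ (λ l → β l * μ₂ l))    ≈⟨ -‿cong (*-cong (δ-μ₁² a b) β-μ₂) ⟩
          - (δ a b * χ)                                         ∎

        Σ-copy-C : ∀ a i l → Σ (λ l′ → μ₁ a * β l′ * N (index (C a l′)) (index (C i l))) ≈ δ a i * (μ₁ a * μ₂ l)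
        Σ-copy-C a i l = begin
          Σ (λ l′ → μ₁ a * β l′ * N (index (C a l′)) (index (C i l)))
            ≈⟨ Σ-cong (λ l′ → trans (*-congˡ (N-CC a l′ i l))
                                    (solve 4 (λ s b d c → s :* b :* (d :* c) := d :* (s :* (b :* c)))
                                           refl (μ₁ a) (β l′) (δ a i) (charMat x A₂ l′ l))) ⟩
          Σ (λ l′ → δ a i * (μ₁ a * (β l′ * charMat x A₂ l′ l)))  ≈⟨ Σ-*ˡ (δ a i) (λ l′ → μ₁ a * (β l′ * charMat x A₂ l′ l)) ⟩
          δ a i * Σ (λ l′ → μ₁ a * (β l′ * charMat x A₂ l′ l))    ≈⟨ *-congˡ (Σ-*ˡ (μ₁ a) (λ l′ → β l′ * charMat x A₂ l′ l)) ⟩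
          δ a i * (μ₁ a * Σ (λ l′ → β l′ * charMat x A₂ l′ l))    ≈⟨ *-congˡ (*-congˡ (β-charMat l)) ⟩
          δ a i * (μ₁ a * μ₂ l)                                    ∎

        rowA : ∀ a j → K (index (A a)) j ≈ N (index (A a)) j + Σ (λ l → μ₁ a * β l * N (index (C a l)) j)
        rowA a j with vertexIndex j
        ... | vertex (U u) = begin
          K (index (A a)) (index (U u))   ≈⟨ trans (K-T _ _) (crossBlock-ʳˡ x (x - χ) Mμ a u) ⟩
          - Mμ a u                        ≈⟨ +-identityʳ _ ⟨
          - Mμ a u + 0#                   ≈⟨ +-cong (sym (N-AU a u)) (sym (Σ-≈0 (λ l → trans (*-congˡ (N-CU a l u)) (zeroʳ _)))) ⟩
          N (index (A a)) (index (U u)) + Σ (λ l → μ₁ a * β l * N (index (C a l)) (index (U u))) ∎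
        ... | vertex (A b) = begin
          K (index (A a)) (index (A b))   ≈⟨ trans (K-T _ _) (crossBlock-ʳʳ x (x - χ) Mμ a b) ⟩
          (x - χ) * δ a b                 ≈⟨ solve 3 (λ x c d → (x :- c) :* d := x :* d :+ :- (d :* c)) refl x χ (δ a b) ⟩
          x * δ a b + - (δ a b * χ)       ≈⟨ +-cong (N-AA a b) (Σ-copy-A a b) ⟨
          N (index (A a)) (index (A b)) + Σ (λ l → μ₁ a * β l * N (index (C a l)) (index (A b))) ∎
        ... | vertex (C i l) = begin
          K (index (A a)) (index (C i l))                    ≈⟨ K-O _ _ ⟩
          0#                                                 ≈⟨ -‿inverseˡ _ ⟨
          - (δ a i * (μ₁ a * μ₂ l)) + δ a i * (μ₁ a * μ₂ l)  ≈⟨ +-cong (N-AC a i l) (Σ-copy-C a i l) ⟨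
          N (index (A a)) (index (C i l)) + Σ (λ l′ → μ₁ a * β l′ * N (index (C a l′)) (index (C i l))) ∎

        upperRows : ∀ i j → K (i ↑ˡ k) j ≈ N (i ↑ˡ k) j + Σ (λ p → X i p * N ((n₁ ℕ.+ n₁) ↑ʳ p) j)
        upperRows i j with blockIndex n₁ i
        ... | upper u = trans (rowU u j) (sym (trans (+-congˡ (Σ-≈0 (λ p → trans (*-congʳ (X-U u p)) (zeroˡ _)))) (+-identityʳ _)))
        ... | lower a = trans (rowA a j)
                              (+-congˡ (sym (trans (Σ-cong (λ p → *-congʳ (X-A a p))) (Σ-W a (λ p → N ((n₁ ℕ.+ n₁) ↑ʳ p) j)))))

        lowerRows : ∀ p j → K ((n₁ ℕ.+ n₁) ↑ʳ p) j ≈ N ((n₁ ℕ.+ n₁) ↑ʳ p) j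
        lowerRows p j with blockIndex (n₁ ℕ.+ n₁) j
        ... | upper i  = reflexive (fromBlocks-ʳˡ T O BL BR p i)
        ... | lower p′ = reflexive (fromBlocks-ʳʳ T O BL BR p p′)

        charPoly-corona : charPoly (adjMat (corona Γ₁ Γ₂)) x ≈ det (crossBlock x (x - χ) Mμ) * charPoly A₂ x ^ n₁
        charPoly-corona = begin
          charPoly (adjMat (corona Γ₁ Γ₂)) x ≈⟨ det-N ⟨
          det N                              ≈⟨ det-addToUpperRows (n₁ ℕ.+ n₁) X N K upperRows lowerRows ⟨
          det K                              ≈⟨ det-fromBlocks-lowerTriangular T O BL BR (λ _ _ → refl) ⟩
          det T * det BR                     ≈⟨ *-congˡ (det-blockDiagonal n₁ BR (charMat x A₂) (λ i j l m → N-CC i l j m)) ⟩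
          det T * charPoly A₂ x ^ n₁         ∎

mainTheorem5 : ∀ {c ℓ} (R : CommutativeRing c ℓ) → Over.CharZeroField R →
    ∀ {n₁ n₂ : ℕ} (Γ₁ : SignedGraph n₁) (Γ₂ : SignedGraph n₂) →
    let open CommutativeRing R
        open Over R
    in (λ₂ : Fin n₂ → Carrier) → IsEigenvalues (adjMat Γ₂) λ₂ →
       (λ₁′ : Fin n₁ → Carrier) → IsEigenvalues (adjMat (muGraph Γ₁)) λ₁′ →
       (x : Carrier) (B : Matrix n₂) → IsInverse (charMat x (adjMat Γ₂)) B →
       charPoly (adjMat (corona Γ₁ Γ₂)) x
         ≈ Π (λ i → (x - λ₂ i) ^ n₁)
           * Π (λ i → x * x - x * coronal Γ₂ B - λ₁′ i * λ₁′ i)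
mainTheorem5 R charZeroField {n₁} Γ₁ Γ₂ λ₂ eigen₂ λ₁′ eigen₁ x B B-inverse = begin
  charPoly (adjMat (corona Γ₁ Γ₂)) x
    ≈⟨ charPoly-corona ⟩
  det (crossBlock x (x - χ) Mμ) * charPoly A₂ x ^ n₁
    ≈⟨ *-cong (det-crossBlock {M = Mμ} eigen₁ x (x - χ)) (^-cong n₁ (eigen₂ x)) ⟩
  Π (λ i → x * (x - χ) - λ₁′ i * λ₁′ i) * Π (λ i → x - λ₂ i) ^ n₁
    ≈⟨ *-comm _ _ ⟩
  Π (λ i → x - λ₂ i) ^ n₁ * Π (λ i → x * (x - χ) - λ₁′ i * λ₁′ i)
    ≈⟨ *-cong (Π-^ (λ i → x - λ₂ i) n₁)
              (Π-cong {f = λ i → x * x - x * χ - λ₁′ i * λ₁′ i} (λ i → +-congʳ (sym (x[y-z]≈xy-xz x x χ)))) ⟨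
  Π (λ i → (x - λ₂ i) ^ n₁) * Π (λ i → x * x - x * χ - λ₁′ i * λ₁′ i) ∎
  where
  open CommutativeRing R
  open Over R
  open RingProperties ring using (x[y-z]≈xy-xz)
  open Development R
  open WithField charZeroField
  open Corona Γ₁ Γ₂
  open CharMatrix x
  open Elimination B B-inverse
  open import Relation.Binary.Reasoning.Setoid setoid
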